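{- Let $C_n$ be the cycle graph on $n\ge3$ vertices. Then $n(C_n)=2n$.
   Context: A word $w$ over the alphabet $V$ word-represents a graph $G=(V,E)$ if $w$ contains every letter of $V$ at least once and for all distinct $x,y\in V$, $xy\in E$ if and only if $x$ and $y$ alternate in $w$ (the subword of $w$ consisting only of occurrences of $x$ and $y$ has no two equal consecutive letters). $\ell(G)$ is the minimum length of a word that word-represents $G$, and $n(G)$ is the number of words of length $\ell(G)$ that word-represent $G$. -}

module Defs where

open import Data.Bool using (Bool; true; false; _∧_; _∨_; not; T)
open import Data.Nat using (ℕ; zero; suc; _≤_; _%_) renaming (_≡ᵇ_ to _≡ℕᵇ_)
open import Data.Fin using (Fin; toℕ; _≟_)
open import Data.List using (List; []; _∷_; filter; length; allFin)
open import Data.Bool.ListAction using (any; all)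
open import Data.Bool.Properties using (T?)
open import Data.Vec using (Vec; toList)
open import Data.Product using (Σ; _×_)
open import Relation.Nullary.Decidable using (⌊_⌋)

_=ᶠ_ : ∀ {n} → Fin n → Fin n → Bool
x =ᶠ y = ⌊ x ≟ y ⌋

_⇔ᵇ_ : Bool → Bool → Bool
true  ⇔ᵇ b = b
false ⇔ᵇ b = not b

noRepeat : ∀ {n} → List (Fin n) → Bool
noRepeat []            = true
noRepeat (a ∷ [])      = true
noRepeat (a ∷ b ∷ w)   = not (a =ᶠ b) ∧ noRepeat (b ∷ w)

alternate : ∀ {n} → Fin n → Fin n → List (Fin n) → Bool
alternate x y w = noRepeat (filter (λ z → T? (z =ᶠ x ∨ z =ᶠ y)) w)

Graph : ℕ → Set
Graph n = Fin n → Fin n → Bool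

represents : ∀ {n} → Graph n → List (Fin n) → Bool
represents {n} G w =
  all (λ x → any (λ z → z =ᶠ x) w) (allFin n) ∧
  all (λ x → all (λ y → (x =ᶠ y) ∨ (G x y ⇔ᵇ alternate x y w)) (allFin n)) (allFin n)

IsMinReprLength : ∀ {n} → Graph n → ℕ → Set
IsMinReprLength {n} G L =
  Σ (Vec (Fin n) L) (λ w → T (represents G (toList w))) ×
  (∀ (w : List (Fin n)) → T (represents G w) → L ≤ length w)

cycleGraph : (n : ℕ) → Graph n
cycleGraph zero ()
cycleGraph (suc m) x y =
  (toℕ y ≡ℕᵇ (suc (toℕ x) % suc m)) ∨ (toℕ x ≡ℕᵇ (suc (toℕ y) % suc m))

-- Write n = m + 1.  For n ≥ 4 the cycle is triangle-free, and letters occurring once in a representing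
-- word pairwise alternate, hence are pairwise adjacent: there are at most two of them, so counting
-- occurrences gives length ≥ 2n − 2 = 2m.  In a word of length 2m every letter occurs at most twice and
-- exactly two occur once.  Between the two occurrences of a doubled letter x lie exactly the two
-- neighbours of x: a non-neighbour there would pull every non-neighbour of x in with it, leaving the
-- neighbours of x as the two singletons, which would then be adjacent, closing a triangle with x.  Hence
-- the word is determined by its first two letters, which are adjacent, and up to a symmetry of the cycle
-- it is 1 0 2 1 3 2 … m (m−1).  Its 2n images under the symmetries are distinct, since they differ in
-- their first two letters.  For n = 3 the shortest words are the 3! = 6 permutations.
module Submission where

open import Defs
open import Data.Bool using (Bool; true; false; _∧_; _∨_; not; T; if_then_else_)
open import Data.Bool.ListAction using (all; any)
open import Data.Bool.Properties using (T?; T-∧; T-≡; T-∨; T-irrelevant; ∨-comm; ∧-zeroʳ)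
open import Data.Empty using (⊥; ⊥-elim)
open import Data.Fin using (Fin; toℕ; fromℕ<; opposite; _≟_) renaming (suc to 1+_)
open import Data.Fin.Patterns using (0F; 1F; 2F; 3F; 4F; 5F)
import Data.Fin.Properties as Fin
open import Data.Fin.Properties
  using (toℕ-fromℕ<; toℕ-injective; toℕ≤pred[n]; opposite-prop; opposite-involutive; *↔×; 2↔Bool)
open import Data.List using (List; []; _∷_; _++_; length; map; filter; replicate; allFin)
open import Data.List.Membership.Propositional.Properties using (∈-allFin)
open import Data.List.Properties
  using (filter-++; map-++; length-map; length-++; ++-assoc; ++-identityʳ; ∷-injective; ∷-injectiveˡ; ∷-injectiveʳ)
open import Data.List.Relation.Unary.All as All using (All)
open import Data.List.Relation.Unary.All.Properties using (all⁺; all⁻)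
open import Data.Nat
  using (ℕ; zero; suc; _+_; _*_; _∸_; _%_; _≤_; _<_; _≤′_; ≤′-step; ≤′-refl; _≤?_; _≤ᵇ_; _≡ᵇ_; z≤n; s≤s)
  renaming (_≟_ to _≟ℕ_)
open import Data.Nat.DivMod using (m%n<n; m<n⇒m%n≡m; n%n≡0)
open import Data.Nat.Properties
  using ( *-comm; *-identityʳ; *-zeroʳ; +-assoc; +-cancelʳ-≤; +-cancelˡ-≡; +-cancelˡ-≤; +-comm; +-identityʳ
        ; +-mono-≤; +-monoʳ-≤; +-suc; <-irrefl; <-trans; <-≤-trans; <⇒≢; <⇒≤; m+[n∸m]≡n; m<n⇒n≢0
        ; m∸n≡0⇒m≤n; m∸n≤m; m≤m+n; m≤n+m; n<1+n; n∸n≡0; n≤0⇒n≡0; n≤1+n; suc-injective; ≡ᵇ⇒≡; ≡⇒≡ᵇ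
        ; ≤-antisym; ≤-refl; ≤-reflexive; ≤-total; ≤-trans; ≤′⇒≤; ≤⇒≤′; ≤∧≢⇒<; ≰⇒>
        ; +-0-commutativeMonoid; module ≤-Reasoning )
open import Algebra.Properties.CommutativeMonoid.Sum +-0-commutativeMonoid using (sum; ∑-distrib-+; sum-cong-≗)
open import Data.Product using (Σ; _×_; _,_; ∃; ∃₂; proj₁; proj₂)
open import Data.Product.Function.NonDependent.Propositional using (_×-↔_)
open import Data.Sum using (_⊎_; inj₁; inj₂; [_,_]′) renaming (map to map-⊎)
open import Data.Vec using (Vec; []; _∷_; toList; fromList; cast)
open import Data.Vec.Properties using (toList-cast; toList∘fromList; toList-injective; cast-is-id; length-toList)
open import Function using (_∘_; _⇔_; mk⇔; Equivalence)
open import Function.Bundles using (_↔_; mk↔ₛ′)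
open import Function.Properties.Inverse using (↔-refl; ↔-trans)
open import Relation.Nullary using (¬_; Dec; yes; no; contradiction)
open import Relation.Binary.PropositionalEquality
  using (_≡_; _≢_; refl; sym; trans; cong; cong₂; subst; subst₂; ≢-sym; module ≡-Reasoning)

private variable k m : ℕ

=ᶠ-refl : (x : Fin k) → (x =ᶠ x) ≡ true
=ᶠ-refl x with x ≟ x
... | yes _   = refl
... | no x≢x = contradiction refl x≢x

=ᶠ-≢ : {x y : Fin k} → x ≢ y → (x =ᶠ y) ≡ false
=ᶠ-≢ {x = x} {y} x≢y with x ≟ y
... | yes x≡y = contradiction x≡y x≢y
... | no _    = refl

=ᶠ⇒≡ : {x y : Fin k} → T (x =ᶠ y) → x ≡ y
=ᶠ⇒≡ {x = x} {y} t with x ≟ y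
... | yes x≡y = x≡y

=ᶠ-sym : (x y : Fin k) → (x =ᶠ y) ≡ (y =ᶠ x)
=ᶠ-sym x y with x ≟ y
... | yes refl = sym (=ᶠ-refl x)
... | no x≢y   = sym (=ᶠ-≢ (≢-sym x≢y))

count : Fin k → List (Fin k) → ℕ
count x []      = 0
count x (a ∷ w) with a ≟ x
... | yes _ = suc (count x w)
... | no _  = count x w

count-here : (x : Fin k) (w : List (Fin k)) → count x (x ∷ w) ≡ suc (count x w)
count-here x w with x ≟ x
... | yes _   = refl
... | no x≢x = contradiction refl x≢x

count-there : {a x : Fin k} (w : List (Fin k)) → a ≢ x → count x (a ∷ w) ≡ count x w
count-there {a = a} {x} w a≢x with a ≟ x
... | yes a≡x = contradiction a≡x a≢x
... | no _    = refl

count-++ : (x : Fin k) (u v : List (Fin k)) → count x (u ++ v) ≡ count x u + count x v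
count-++ x []      v = refl
count-++ x (a ∷ u) v with a ≟ x
... | yes _ = cong suc (count-++ x u v)
... | no _  = count-++ x u v

occurs-head : (a : Fin k) (M : List (Fin k)) → 1 ≤ count a (a ∷ M)
occurs-head a M = subst (1 ≤_) (sym (count-here a M)) (s≤s z≤n)

count-here≢0 : (a : Fin k) (M : List (Fin k)) → count a (a ∷ M) ≢ 0
count-here≢0 a M a∉ = contradiction (trans (sym (count-here a M)) a∉) λ ()

occurs-∷ : (y a : Fin k) (M : List (Fin k)) → 1 ≤ count y M → 1 ≤ count y (a ∷ M)
occurs-∷ y a M y∈M = subst (1 ≤_) (sym (count-++ y (a ∷ []) M)) (≤-trans y∈M (m≤n+m _ _))

count-around : {x y : Fin k} (X M Y : List (Fin k)) → x ≢ y →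
  count y (X ++ x ∷ M ++ x ∷ Y) ≡ count y X + (count y M + count y Y)
count-around {x = x} {y} X M Y x≢y = begin
  count y (X ++ x ∷ M ++ x ∷ Y)        ≡⟨ count-++ y X _ ⟩
  count y X + count y (x ∷ M ++ x ∷ Y) ≡⟨ cong (count y X +_) (count-there _ x≢y) ⟩
  count y X + count y (M ++ x ∷ Y)     ≡⟨ cong (count y X +_) (count-++ y M _) ⟩
  count y X + (count y M + count y (x ∷ Y)) ≡⟨ cong (λ n → count y X + (count y M + n)) (count-there Y x≢y) ⟩
  count y X + (count y M + count y Y)  ∎
  where open ≡-Reasoning

count-around-self : (x : Fin k) (X M Y : List (Fin k)) →
  count x X ≡ 0 → count x M ≡ 0 → count x Y ≡ 0 → count x (X ++ x ∷ M ++ x ∷ Y) ≡ 2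
count-around-self x X M Y X∌x M∌x Y∌x = begin
  count x (X ++ x ∷ M ++ x ∷ Y)               ≡⟨ count-++ x X _ ⟩
  count x X + count x (x ∷ M ++ x ∷ Y)        ≡⟨ cong₂ _+_ X∌x (count-here x _) ⟩
  suc (count x (M ++ x ∷ Y))                  ≡⟨ cong suc (count-++ x M _) ⟩
  suc (count x M + count x (x ∷ Y))           ≡⟨ cong₂ (λ a b → suc (a + b)) M∌x (count-here x Y) ⟩
  suc (suc (count x Y))                       ≡⟨ cong (suc ∘ suc) Y∌x ⟩
  2                                           ∎
  where open ≡-Reasoning

split-first : (x : Fin k) (w : List (Fin k)) → 1 ≤ count x w →
  ∃₂ λ X Y → w ≡ X ++ x ∷ Y × count x X ≡ 0 × suc (count x Y) ≡ count x w
split-first x (a ∷ w) x∈w with a ≟ x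
... | yes refl = [] , w , refl , refl , refl
... | no a≢x with split-first x w x∈w
...   | X , Y , refl , X∌x , Y# = a ∷ X , Y , refl , trans (count-there X a≢x) X∌x , Y#

split-twice : (x : Fin k) (w : List (Fin k)) → count x w ≡ 2 →
  ∃₂ λ X M → ∃ λ Y →
    w ≡ X ++ x ∷ M ++ x ∷ Y × count x X ≡ 0 × count x M ≡ 0 × count x Y ≡ 0
split-twice x w w#
  with split-first x w (subst (1 ≤_) (sym w#) (s≤s z≤n))
... | X , B , refl , X∌x , B#
  with split-first x B (subst (1 ≤_) (sym (suc-injective (trans B# w#))) (s≤s z≤n))
...   | M , Y , refl , M∌x , Y# =
  X , M , Y , refl , X∌x , M∌x , suc-injective (trans Y# (suc-injective (trans B# w#)))

first-occurrence-unique : {x : Fin k} (u v u′ v′ : List (Fin k)) → u ++ x ∷ v ≡ u′ ++ x ∷ v′ →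
  count x u ≡ 0 → count x u′ ≡ 0 → u ≡ u′ × v ≡ v′
first-occurrence-unique []      v []       v′ eq _ _ = refl , ∷-injectiveʳ eq
first-occurrence-unique {x = x} []      v (c ∷ u′) v′ eq _ c∷u′∌x =
  contradiction (subst (λ d → count x (d ∷ u′) ≡ 0) (sym (∷-injectiveˡ eq)) c∷u′∌x) (count-here≢0 x u′)
first-occurrence-unique {x = x} (c ∷ u) v []       v′ eq c∷u∌x _ =
  contradiction (subst (λ d → count x (d ∷ u) ≡ 0) (∷-injectiveˡ eq) c∷u∌x) (count-here≢0 x u)
first-occurrence-unique {x = x} (c ∷ u) v (c′ ∷ u′) v′ eq c∷u∌x c′∷u′∌x with ∷-injective eq
... | refl , eq′ = by-cases (c ≟ x)
  where
  by-cases : Dec (c ≡ x) → c ∷ u ≡ c ∷ u′ × v ≡ v′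
  by-cases (yes refl) = contradiction c∷u∌x (count-here≢0 c u)
  by-cases (no c≢x)   =
    let u≡u′ , v≡v′ = first-occurrence-unique u v u′ v′ eq′ (trans (sym (count-there u c≢x)) c∷u∌x)
                                                          (trans (sym (count-there u′ c≢x)) c′∷u′∌x)
    in cong (c ∷_) u≡u′ , v≡v′

head-in-prefix : {a z : Fin k} (r X M : List (Fin k)) → a ∷ r ≡ X ++ z ∷ M → a ≢ z → 1 ≤ count a X
head-in-prefix r []      M eq a≢z = contradiction (∷-injectiveˡ eq) a≢z
head-in-prefix {a = a} r (d ∷ X) M eq _ = subst (λ e → 1 ≤ count a (e ∷ X)) (∷-injectiveˡ eq) (occurs-head a X)

regroup : {A : Set} (X A′ C D Y : List A) (x j : A) →
  X ++ x ∷ (A′ ++ j ∷ C ++ j ∷ D) ++ x ∷ Y ≡ (X ++ x ∷ A′) ++ j ∷ C ++ j ∷ (D ++ x ∷ Y)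
regroup X A′ C D Y x j = begin
  X ++ x ∷ (A′ ++ j ∷ C ++ j ∷ D) ++ x ∷ Y   ≡⟨ cong (λ v → X ++ x ∷ v) (++-assoc A′ (j ∷ C ++ j ∷ D) (x ∷ Y)) ⟩
  X ++ x ∷ A′ ++ j ∷ (C ++ j ∷ D) ++ x ∷ Y   ≡⟨ cong (λ v → X ++ x ∷ A′ ++ j ∷ v) (++-assoc C (j ∷ D) (x ∷ Y)) ⟩
  X ++ x ∷ A′ ++ j ∷ C ++ j ∷ D ++ x ∷ Y     ≡⟨ sym (++-assoc X (x ∷ A′) (j ∷ C ++ j ∷ D ++ x ∷ Y)) ⟩
  (X ++ x ∷ A′) ++ j ∷ C ++ j ∷ D ++ x ∷ Y   ∎
  where open ≡-Reasoning

map-around : {A B : Set} (f : A → B) (X M Y : List A) (x : A) →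
  map f (X ++ x ∷ M ++ x ∷ Y) ≡ map f X ++ f x ∷ map f M ++ f x ∷ map f Y
map-around f X M Y x = trans (map-++ f X _) (cong (λ v → map f X ++ f x ∷ v) (map-++ f M (x ∷ Y)))

Over : Fin k → Fin k → List (Fin k) → Set
Over a b M = ∀ y → 1 ≤ count y M → y ≡ a ⊎ y ≡ b

private
  over-tail : {a b : Fin k} (c : Fin k) (M : List (Fin k)) → Over a b (c ∷ M) → Over a b M
  over-tail c M over y y∈M = over y (occurs-∷ y c M y∈M)

  over-swap : (a b : Fin k) (M : List (Fin k)) → Over a b M → Over b a M
  over-swap a b M over y y∈M with over y y∈M
  ... | inj₁ y≡a = inj₂ y≡a
  ... | inj₂ y≡b = inj₁ y≡b

  empty-list : {a b : Fin k} (M : List (Fin k)) → Over a b M → count a M ≡ 0 → count b M ≡ 0 → M ≡ []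
  empty-list []      _      _  _  = refl
  empty-list (c ∷ M) over a∉ b∉ with over c (occurs-head c M)
  ... | inj₁ refl = contradiction a∉ (count-here≢0 c M)
  ... | inj₂ refl = contradiction b∉ (count-here≢0 c M)

  singleton-list : {a b : Fin k} (M : List (Fin k)) → b ≢ a → Over a b M →
    count a M ≡ 0 → count b M ≡ 1 → M ≡ b ∷ []
  singleton-list (c ∷ M) b≢a over a∉ b-once with over c (occurs-head c M)
  ... | inj₁ refl = contradiction a∉ (count-here≢0 c M)
  ... | inj₂ refl = cong (c ∷_) (empty-list M (over-tail c M over)
                      (trans (sym (count-there M b≢a)) a∉) (suc-injective (trans (sym (count-here c M)) b-once)))

pair-list : {a b : Fin k} (M : List (Fin k)) → a ≢ b → Over a b M →
  count a M ≡ 1 → count b M ≡ 1 → M ≡ a ∷ b ∷ [] ⊎ M ≡ b ∷ a ∷ []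
pair-list (c ∷ M) a≢b over a-once b-once with over c (occurs-head c M)
... | inj₁ refl = inj₁ (cong (c ∷_) (singleton-list M (≢-sym a≢b) (over-tail c M over)
                    (suc-injective (trans (sym (count-here c M)) a-once)) (trans (sym (count-there M a≢b)) b-once)))
... | inj₂ refl = inj₂ (cong (c ∷_) (singleton-list M a≢b (over-swap _ _ M (over-tail c M over))
                    (suc-injective (trans (sym (count-here c M)) b-once)) (trans (sym (count-there M (≢-sym a≢b))) a-once)))

-- the filter used by alternate, so that alternate x y w is noRepeat (subword x y w) by definition
subword : Fin k → Fin k → List (Fin k) → List (Fin k)
subword x y = filter (λ z → T? (z =ᶠ x ∨ z =ᶠ y))

subword-++ : (x y : Fin k) (u v : List (Fin k)) →
  subword x y (u ++ v) ≡ subword x y u ++ subword x y v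
subword-++ x y = filter-++ (λ z → T? (z =ᶠ x ∨ z =ᶠ y))

subword-∷ˡ : (x y : Fin k) (v : List (Fin k)) → subword x y (x ∷ v) ≡ x ∷ subword x y v
subword-∷ˡ x y v rewrite =ᶠ-refl x = refl

subword-∷ʳ : (x y : Fin k) (v : List (Fin k)) → subword x y (y ∷ v) ≡ y ∷ subword x y v
subword-∷ʳ x y v rewrite =ᶠ-refl y | ∨-comm (y =ᶠ x) true = refl

subword-∷-other : {x y a : Fin k} (v : List (Fin k)) → a ≢ x → a ≢ y →
  subword x y (a ∷ v) ≡ subword x y v
subword-∷-other v a≢x a≢y rewrite =ᶠ-≢ a≢x | =ᶠ-≢ a≢y = refl

subword-without : (x y : Fin k) (v : List (Fin k)) → count x v ≡ 0 →
  subword x y v ≡ replicate (count y v) y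
subword-without x y []      _   = refl
subword-without x y (a ∷ v) a∷v∌x = by-cases (a ≟ x) (a ≟ y)
  where
  by-cases : Dec (a ≡ x) → Dec (a ≡ y) → subword x y (a ∷ v) ≡ replicate (count y (a ∷ v)) y
  by-cases (yes refl) _ = contradiction a∷v∌x (count-here≢0 a v)
  by-cases (no a≢x) (yes refl) =
    trans (subword-∷ʳ x a v)
      (trans (cong (a ∷_) (subword-without x a v (trans (sym (count-there v a≢x)) a∷v∌x)))
             (cong (λ n → replicate n a) (sym (count-here a v))))
  by-cases (no a≢x) (no a≢y) =
    trans (subword-∷-other v a≢x a≢y)
      (trans (subword-without x y v (trans (sym (count-there v a≢x)) a∷v∌x))
             (cong (λ n → replicate n y) (sym (count-there v a≢y))))

subword-comm : (x y : Fin k) (v : List (Fin k)) → subword x y v ≡ subword y x v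
subword-comm x y []      = refl
subword-comm x y (a ∷ v) rewrite ∨-comm (a =ᶠ x) (a =ᶠ y) with a =ᶠ y ∨ a =ᶠ x
... | true  = cong (a ∷_) (subword-comm x y v)
... | false = subword-comm x y v

alternate-comm : (x y : Fin k) (v : List (Fin k)) → alternate x y v ≡ alternate y x v
alternate-comm x y v = cong noRepeat (subword-comm x y v)

noRepeat-replicate-∷ : {x y : Fin k} → x ≢ y → (a : ℕ) (v : List (Fin k)) →
  noRepeat (replicate a y ++ x ∷ v) ≡ (a ≤ᵇ 1) ∧ noRepeat (x ∷ v)
noRepeat-replicate-∷ x≢y 0 v = refl
noRepeat-replicate-∷ x≢y 1 v rewrite =ᶠ-≢ (≢-sym x≢y) = refl
noRepeat-replicate-∷ {y = y} x≢y (suc (suc a)) v rewrite =ᶠ-refl y = refl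

noRepeat-∷-replicate-∷ : {x y : Fin k} → x ≢ y → (b : ℕ) (v : List (Fin k)) →
  noRepeat (x ∷ replicate b y ++ x ∷ v) ≡ (b ≡ᵇ 1) ∧ noRepeat (x ∷ v)
noRepeat-∷-replicate-∷ {x = x} x≢y 0 v rewrite =ᶠ-refl x = refl
noRepeat-∷-replicate-∷ x≢y 1 v rewrite =ᶠ-≢ x≢y | =ᶠ-≢ (≢-sym x≢y) = refl
noRepeat-∷-replicate-∷ {y = y} x≢y (suc (suc b)) v rewrite =ᶠ-≢ x≢y | =ᶠ-refl y = refl

noRepeat-∷-replicate : {x y : Fin k} → x ≢ y → (c : ℕ) → noRepeat (x ∷ replicate c y) ≡ (c ≤ᵇ 1)
noRepeat-∷-replicate x≢y 0 = refl
noRepeat-∷-replicate x≢y 1 rewrite =ᶠ-≢ x≢y = refl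
noRepeat-∷-replicate {y = y} x≢y (suc (suc c)) rewrite =ᶠ-≢ x≢y | =ᶠ-refl y = refl

private
  middle-decides : ∀ a b c → a + (b + c) ≤ 2 → (a ≤ᵇ 1) ∧ ((b ≡ᵇ 1) ∧ (c ≤ᵇ 1)) ≡ (b ≡ᵇ 1)
  middle-decides a 0             c _ = ∧-zeroʳ (a ≤ᵇ 1)
  middle-decides a (suc (suc b)) c _ = ∧-zeroʳ (a ≤ᵇ 1)
  middle-decides 0 1 0 _ = refl
  middle-decides 0 1 1 _ = refl
  middle-decides 1 1 0 _ = refl
  middle-decides 0 1 (suc (suc c)) (s≤s (s≤s ()))
  middle-decides 1 1 (suc c)       (s≤s (s≤s ()))
  middle-decides (suc (suc a)) 1 c (s≤s (s≤s a+1+c≤0)) =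
    contradiction (subst (_≤ 0) (+-suc a c) a+1+c≤0) λ ()

  one-sided : ∀ a b → a + b ≡ 1 → (a ≤ᵇ 1) ∧ (b ≤ᵇ 1) ≡ true
  one-sided 0 1 _ = refl
  one-sided 1 0 _ = refl

subword-around : (x y : Fin k) (X M Y : List (Fin k)) →
  subword x y (X ++ x ∷ M ++ x ∷ Y) ≡ subword x y X ++ x ∷ subword x y M ++ x ∷ subword x y Y
subword-around x y X M Y = begin
  subword x y (X ++ x ∷ M ++ x ∷ Y)                   ≡⟨ subword-++ x y X _ ⟩
  subword x y X ++ subword x y (x ∷ M ++ x ∷ Y)       ≡⟨ cong (subword x y X ++_) (subword-∷ˡ x y _) ⟩
  subword x y X ++ x ∷ subword x y (M ++ x ∷ Y)       ≡⟨ cong (λ v → subword x y X ++ x ∷ v) (subword-++ x y M _) ⟩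
  subword x y X ++ x ∷ subword x y M ++ subword x y (x ∷ Y)
    ≡⟨ cong (λ v → subword x y X ++ x ∷ subword x y M ++ v) (subword-∷ˡ x y Y) ⟩
  subword x y X ++ x ∷ subword x y M ++ x ∷ subword x y Y ∎
  where open ≡-Reasoning

alternate-around : {x y : Fin k} (X M Y : List (Fin k)) → x ≢ y →
  count x X ≡ 0 → count x M ≡ 0 → count x Y ≡ 0 → count y (X ++ x ∷ M ++ x ∷ Y) ≤ 2 →
  alternate x y (X ++ x ∷ M ++ x ∷ Y) ≡ (count y M ≡ᵇ 1)
alternate-around {x = x} {y} X M Y x≢y X∌x M∌x Y∌x y≤2
  rewrite subword-around x y X M Y
        | subword-without x y X X∌x | subword-without x y M M∌x | subword-without x y Y Y∌x
        | noRepeat-replicate-∷ x≢y (count y X) (replicate (count y M) y ++ x ∷ replicate (count y Y) y)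
        | noRepeat-∷-replicate-∷ x≢y (count y M) (replicate (count y Y) y)
        | noRepeat-∷-replicate x≢y (count y Y)
  = middle-decides (count y X) (count y M) (count y Y) (subst (_≤ 2) (count-around X M Y x≢y) y≤2)

alternate-once : {x y : Fin k} (w : List (Fin k)) → x ≢ y → count x w ≡ 1 → count y w ≡ 1 →
  alternate x y w ≡ true
alternate-once {x = x} {y} w x≢y x#1 y#1 with split-first x w (subst (1 ≤_) (sym x#1) (s≤s z≤n))
... | X , Y , refl , X∌x , Y#
  rewrite subword-++ x y X (x ∷ Y) | subword-∷ˡ x y Y
        | subword-without x y X X∌x | subword-without x y Y (suc-injective (trans Y# x#1))
        | noRepeat-replicate-∷ x≢y (count y X) (replicate (count y Y) y)
        | noRepeat-∷-replicate x≢y (count y Y)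
  = one-sided (count y X) (count y Y) y-split
  where
  y-split : count y X + count y Y ≡ 1
  y-split = trans (sym (trans (count-++ y X (x ∷ Y)) (cong (count y X +_) (count-there Y x≢y)))) y#1

record Represents (G : Graph k) (w : List (Fin k)) : Set where
  field
    occurs      : ∀ x → 1 ≤ count x w
    alternation : ∀ x y → x ≢ y → G x y ≡ alternate x y w

T-all-allFin : (p : Fin k → Bool) → T (all p (allFin k)) ⇔ (∀ x → T (p x))
T-all-allFin {k} p =
  mk⇔ (λ t x → All.lookup (all⁺ p _ t) (∈-allFin x)) (λ h → all⁻ p {allFin k} (All.tabulate λ {x} _ → h x))

T-any-=ᶠ : (x : Fin k) (w : List (Fin k)) → T (any (_=ᶠ x) w) ⇔ 1 ≤ count x w
T-any-=ᶠ x w = mk⇔ (to w) (from w)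
  where
  to : ∀ w → T (any (_=ᶠ x) w) → 1 ≤ count x w
  to (a ∷ w) t with a ≟ x
  ... | yes _ = s≤s z≤n
  ... | no _  = to w t
  from : ∀ w → 1 ≤ count x w → T (any (_=ᶠ x) w)
  from (a ∷ w) c with a ≟ x
  ... | yes _ = _
  ... | no _  = from w c

T-=ᶠ-∨-⇔ᵇ : {x y : Fin k} (b c : Bool) → T ((x =ᶠ y) ∨ (b ⇔ᵇ c)) ⇔ (x ≢ y → b ≡ c)
T-=ᶠ-∨-⇔ᵇ {x = x} {y} b c with x ≟ y
... | yes x≡y = mk⇔ (λ _ x≢y → contradiction x≡y x≢y) _
... | no x≢y  = mk⇔ (λ t _ → to b c t) (λ h → from b c (h x≢y))
  where
  to : ∀ b c → T (b ⇔ᵇ c) → b ≡ c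
  to true  true  _ = refl
  to false false _ = refl
  from : ∀ b c → b ≡ c → T (b ⇔ᵇ c)
  from true  _ refl = _
  from false _ refl = _

represents⇔Represents : (G : Graph k) (w : List (Fin k)) → T (represents G w) ⇔ Represents G w
represents⇔Represents {k} G w = mk⇔ from-bool to-bool
  where
  open Equivalence
  from-bool : T (represents G w) → Represents G w
  from-bool t = let occurs , alternation = to T-∧ t in record
    { occurs      = λ x → to (T-any-=ᶠ x w) (to (T-all-allFin _) occurs x)
    ; alternation = λ x y → to (T-=ᶠ-∨-⇔ᵇ (G x y) _) (to (T-all-allFin _) (to (T-all-allFin _) alternation x) y)
    }
  to-bool : Represents G w → T (represents G w)
  to-bool record { occurs = occurs ; alternation = alternation } = from T-∧
    ( from (T-all-allFin _) (λ x → from (T-any-=ᶠ x w) (occurs x))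
    , from (T-all-allFin _) λ x → from (T-all-allFin _) λ y → from (T-=ᶠ-∨-⇔ᵇ (G x y) _) (alternation x y))

module _ {l : ℕ} {σ : Fin k → Fin l} (σ-injective : ∀ {a b} → σ a ≡ σ b → a ≡ b) where

  =ᶠ-map : (a b : Fin k) → (σ a =ᶠ σ b) ≡ (a =ᶠ b)
  =ᶠ-map a b with a ≟ b
  ... | yes refl = =ᶠ-refl (σ a)
  ... | no a≢b   = =ᶠ-≢ (a≢b ∘ σ-injective)

  count-map : (y : Fin k) (w : List (Fin k)) → count (σ y) (map σ w) ≡ count y w
  count-map y [] = refl
  count-map y (a ∷ w) with a ≟ y
  ... | yes refl = trans (count-here (σ a) (map σ w)) (cong suc (count-map a w))
  ... | no a≢y   = trans (count-there (map σ w) (a≢y ∘ σ-injective)) (count-map y w)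

  subword-map : (x y : Fin k) (w : List (Fin k)) → subword (σ x) (σ y) (map σ w) ≡ map σ (subword x y w)
  subword-map x y [] = refl
  subword-map x y (a ∷ w) rewrite =ᶠ-map a x | =ᶠ-map a y with a =ᶠ x ∨ a =ᶠ y
  ... | true  = cong (σ a ∷_) (subword-map x y w)
  ... | false = subword-map x y w

  noRepeat-map : (w : List (Fin k)) → noRepeat (map σ w) ≡ noRepeat w
  noRepeat-map []          = refl
  noRepeat-map (a ∷ [])    = refl
  noRepeat-map (a ∷ b ∷ w) = cong₂ (λ p q → not p ∧ q) (=ᶠ-map a b) (noRepeat-map (b ∷ w))

  alternate-map : (x y : Fin k) (w : List (Fin k)) → alternate (σ x) (σ y) (map σ w) ≡ alternate x y w
  alternate-map x y w = trans (cong noRepeat (subword-map x y w)) (noRepeat-map (subword x y w))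

record Automorphism (G : Graph k) : Set where
  field
    to from   : Fin k → Fin k
    from-to   : ∀ a → from (to a) ≡ a
    to-from   : ∀ a → to (from a) ≡ a
    preserves : ∀ a b → G (to a) (to b) ≡ G a b

  to-injective : ∀ {a b} → to a ≡ to b → a ≡ b
  to-injective {a} {b} eq = trans (sym (from-to a)) (trans (cong from eq) (from-to b))

  from-injective : ∀ {a b} → from a ≡ from b → a ≡ b
  from-injective {a} {b} eq = trans (sym (to-from a)) (trans (cong to eq) (to-from b))

  count-map-to : (z : Fin k) (w : List (Fin k)) → count z (map to w) ≡ count (from z) w
  count-map-to z w = trans (cong (λ y → count y (map to w)) (sym (to-from z))) (count-map to-injective (from z) w)

  map-from-to : (w : List (Fin k)) → map to (map from w) ≡ w
  map-from-to []      = refl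
  map-from-to (a ∷ w) = cong₂ _∷_ (to-from a) (map-from-to w)

  Represents-map : {w : List (Fin k)} → Represents G w → Represents G (map to w)
  Represents-map {w} record { occurs = occurs ; alternation = alternation } =
    record { occurs = occurs′ ; alternation = alternation′ }
    where
    occurs′ : ∀ x → 1 ≤ count x (map to w)
    occurs′ x = subst (1 ≤_) (sym (count-map-to x w)) (occurs (from x))
    alternation′ : ∀ x y → x ≢ y → G x y ≡ alternate x y (map to w)
    alternation′ x y x≢y = begin
      G x y                                   ≡⟨ sym (cong₂ G (to-from x) (to-from y)) ⟩
      G (to (from x)) (to (from y))           ≡⟨ preserves (from x) (from y) ⟩
      G (from x) (from y)                     ≡⟨ alternation (from x) (from y) (x≢y ∘ from-injective) ⟩
      alternate (from x) (from y) w           ≡⟨ sym (alternate-map to-injective (from x) (from y) w) ⟩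
      alternate (to (from x)) (to (from y)) (map to w) ≡⟨ cong₂ (λ a b → alternate a b (map to w)) (to-from x) (to-from y) ⟩
      alternate x y (map to w)                ∎
      where open ≡-Reasoning

module _ {G : Graph k} where
  open Automorphism

  idᴬ : Automorphism G
  idᴬ = record { to = λ a → a ; from = λ a → a ; from-to = λ _ → refl ; to-from = λ _ → refl ; preserves = λ _ _ → refl }

  _∘ᴬ_ : Automorphism G → Automorphism G → Automorphism G
  A ∘ᴬ B = record
    { to        = to A ∘ to B
    ; from      = from B ∘ from A
    ; from-to   = λ a → trans (cong (from B) (from-to A (to B a))) (from-to B a)
    ; to-from   = λ a → trans (cong (to A) (to-from B (from A a))) (to-from A a)
    ; preserves = λ a b → trans (preserves A (to B a) (to B b)) (preserves B a b)
    }

  _⁻¹ᴬ : Automorphism G → Automorphism G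
  A ⁻¹ᴬ = record
    { to        = from A
    ; from      = to A
    ; from-to   = to-from A
    ; to-from   = from-to A
    ; preserves = λ a b → trans (sym (preserves A (from A a) (from A b))) (cong₂ G (to-from A a) (to-from A b))
    }

Represents-≗ : {G H : Graph k} {w : List (Fin k)} → (∀ x y → G x y ≡ H x y) → Represents G w → Represents H w
Represents-≗ G≗H rep = record
  { occurs = Represents.occurs rep
  ; alternation = λ x y x≢y → trans (sym (G≗H x y)) (Represents.alternation rep x y x≢y)
  }

singletons-adjacent : {G : Graph k} {w : List (Fin k)} → Represents G w →
  {x y : Fin k} → x ≢ y → count x w ≡ 1 → count y w ≡ 1 → G x y ≡ true
singletons-adjacent {w = w} rep x≢y x-once y-once =
  trans (Represents.alternation rep _ _ x≢y) (alternate-once w x≢y x-once y-once)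

sum-mono : (f g : Fin k → ℕ) → (∀ y → f y ≤ g y) → sum f ≤ sum g
sum-mono {zero}  f g f≤g = z≤n
sum-mono {suc k} f g f≤g = +-mono-≤ (f≤g 0F) (sum-mono (f ∘ 1+_) (g ∘ 1+_) (f≤g ∘ 1+_))

sum-const : (c : ℕ) → sum {k} (λ _ → c) ≡ k * c
sum-const {zero}  c = refl
sum-const {suc k} c = cong (c +_) (sum-const {k} c)

≤-sum : (f : Fin k → ℕ) (z : Fin k) → f z ≤ sum f
≤-sum f 0F     = m≤m+n (f 0F) _
≤-sum f (1+ z) = ≤-trans (≤-sum (f ∘ 1+_) z) (m≤n+m _ (f 0F))

sum-count-[_] : (a : Fin k) → sum (λ y → count y (a ∷ [])) ≡ 1
sum-count-[_] {suc k} 0F =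
  cong suc (trans (sum-cong-≗ (λ (y : Fin k) → count-there {a = 0F} {x = 1+ y} [] λ ())) (trans (sum-const {k} 0) (*-zeroʳ k)))
sum-count-[_] (1+ a) = trans (sum-cong-≗ (λ y → count-map {σ = 1+_} Fin.suc-injective y (a ∷ []))) sum-count-[ a ]

sum-count : (w : List (Fin k)) → sum (λ y → count y w) ≡ length w
sum-count {k} []      = trans (sum-const {k} 0) (*-zeroʳ k)
sum-count     (a ∷ w) = begin
  sum (λ y → count y (a ∷ w))                        ≡⟨ sum-cong-≗ (λ y → count-++ y (a ∷ []) w) ⟩
  sum (λ y → count y (a ∷ []) + count y w)           ≡⟨ ∑-distrib-+ (λ y → count y (a ∷ [])) (λ y → count y w) ⟩
  sum (λ y → count y (a ∷ [])) + sum (λ y → count y w) ≡⟨ cong₂ _+_ sum-count-[ a ] (sum-count w) ⟩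
  suc (length w)                                     ∎
  where open ≡-Reasoning

positive-term : (f : Fin k → ℕ) → 1 ≤ sum f → ∃ λ s → 1 ≤ f s
positive-term {suc k} f 1≤sum with f 0F in eq
... | suc _ = 0F , subst (1 ≤_) (sym eq) (s≤s z≤n)
... | zero with positive-term (f ∘ 1+_) 1≤sum
...   | s , 1≤fs = 1+ s , 1≤fs

two-unit-terms : (f : Fin k → ℕ) → (∀ y → f y ≤ 1) → 2 ≤ sum f →
  ∃₂ λ s t → s ≢ t × f s ≡ 1 × f t ≡ 1
two-unit-terms {suc k} f f≤1 2≤sum with f 0F in eq | f≤1 0F
... | zero | _ with two-unit-terms (f ∘ 1+_) (f≤1 ∘ 1+_) 2≤sum
...   | s , t , s≢t , fs , ft = 1+ s , 1+ t , s≢t ∘ Fin.suc-injective , fs , ft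
two-unit-terms {suc k} f f≤1 (s≤s 1≤sum) | suc zero | _ with positive-term (f ∘ 1+_) 1≤sum
...   | t , 1≤ft = 0F , 1+ t , (λ ()) , eq , ≤-antisym (f≤1 (1+ t)) 1≤ft
two-unit-terms {suc k} f f≤1 2≤sum | suc (suc _) | s≤s ()

size≤length : {G : Graph k} {w : List (Fin k)} → Represents G w → k ≤ length w
size≤length {k} {w = w} rep = begin
  k                      ≡⟨ sym (*-identityʳ k) ⟩
  k * 1                  ≡⟨ sym (sum-const {k} 1) ⟩
  sum {k} (λ _ → 1)      ≤⟨ sum-mono _ _ (Represents.occurs rep) ⟩
  sum (λ y → count y w)  ≡⟨ sum-count w ⟩
  length w               ∎
  where open ≤-Reasoning

interval-connected : (P : ℕ → Set) {lo hi : ℕ} →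
  (∀ {i} → lo ≤ i → suc i < hi → P i → P (suc i)) →
  (∀ {i} → lo ≤ i → suc i < hi → P (suc i) → P i) →
  ∀ {a b} → lo ≤ a → a < hi → lo ≤ b → b < hi → P a → P b
interval-connected P up down {a} {b} lo≤a a<hi lo≤b b<hi Pa with ≤-total a b
... | inj₁ a≤b = climb (≤⇒≤′ a≤b) b<hi
  where
  climb : ∀ {c} → a ≤′ c → c < _ → P c
  climb ≤′-refl          _      = Pa
  climb (≤′-step a≤′c) c+1<hi = up (≤-trans lo≤a (≤′⇒≤ a≤′c)) c+1<hi (climb a≤′c (<-trans (n<1+n _) c+1<hi))
... | inj₂ b≤a = descend (≤⇒≤′ b≤a) a<hi Pa
  where
  descend : ∀ {c} → b ≤′ c → c < _ → P c → P b
  descend ≤′-refl          _      Pc   = Pc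
  descend (≤′-step b≤′c) c+1<hi Pc+1 =
    descend b≤′c (<-trans (n<1+n _) c+1<hi) (down (≤-trans lo≤b (≤′⇒≤ b≤′c)) c+1<hi Pc+1)

zigzag : {A : Set} → (ℕ → A) → ℕ → List A
zigzag p zero    = []
zigzag p (suc j) = p 1 ∷ p 0 ∷ zigzag (p ∘ suc) j

zigzag-++ : {A : Set} (p : ℕ → A) (i j : ℕ) → zigzag p (i + j) ≡ zigzag p i ++ zigzag (λ l → p (i + l)) j
zigzag-++ p zero    j = refl
zigzag-++ p (suc i) j = cong (λ v → p 1 ∷ p 0 ∷ v) (zigzag-++ (p ∘ suc) i j)

zigzag-snoc : {A : Set} (p : ℕ → A) (j : ℕ) → zigzag p (suc j) ≡ zigzag p j ++ p (suc j) ∷ p j ∷ []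
zigzag-snoc p j = begin
  zigzag p (suc j)                               ≡⟨ cong (zigzag p) (+-comm 1 j) ⟩
  zigzag p (j + 1)                               ≡⟨ zigzag-++ p j 1 ⟩
  zigzag p j ++ p (j + 1) ∷ p (j + 0) ∷ []       ≡⟨ cong₂ (λ a b → zigzag p j ++ p a ∷ p b ∷ []) (+-comm j 1) (+-identityʳ j) ⟩
  zigzag p j ++ p (suc j) ∷ p j ∷ []             ∎
  where open ≡-Reasoning

length-zigzag : {A : Set} (p : ℕ → A) (j : ℕ) → length (zigzag p j) ≡ j + j
length-zigzag p zero    = refl
length-zigzag p (suc j) = cong suc (trans (cong suc (length-zigzag (p ∘ suc) j)) (sym (+-suc j j)))

count-zigzag-absent : (p : ℕ → Fin k) (z : Fin k) (j : ℕ) → (∀ i → i ≤ j → p i ≢ z) → count z (zigzag p j) ≡ 0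
count-zigzag-absent p z zero    _    = refl
count-zigzag-absent p z (suc j) p≢z =
  trans (count-there _ (p≢z 1 (s≤s z≤n))) (trans (count-there _ (p≢z 0 z≤n))
    (count-zigzag-absent (p ∘ suc) z j (λ i i≤j → p≢z (suc i) (s≤s i≤j))))

3≤⇒1≤ : 3 ≤ m → 1 ≤ m
3≤⇒1≤ (s≤s _) = s≤s z≤n

3≤⇒2≤ : 3 ≤ m → 2 ≤ m
3≤⇒2≤ (s≤s (s≤s _)) = s≤s (s≤s z≤n)

1+[m∸1]≡m : 1 ≤ m → suc (m ∸ 1) ≡ m
1+[m∸1]≡m (s≤s _) = refl

opaque
  next : Fin (suc m) → Fin (suc m)
  next {m} x = fromℕ< (m%n<n (suc (toℕ x)) (suc m))

  toℕ-next : (x : Fin (suc m)) → toℕ (next x) ≡ suc (toℕ x) % suc m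
  toℕ-next {m} x = toℕ-fromℕ< (m%n<n (suc (toℕ x)) (suc m))

toℕ-next-< : (x : Fin (suc m)) → toℕ x < m → toℕ (next x) ≡ suc (toℕ x)
toℕ-next-< x x<m = trans (toℕ-next x) (m<n⇒m%n≡m (s≤s x<m))

toℕ-next-last : (x : Fin (suc m)) → toℕ x ≡ m → toℕ (next x) ≡ 0
toℕ-next-last {m} x x≡m = trans (toℕ-next x) (trans (cong (λ k → suc k % suc m) x≡m) (n%n≡0 (suc m)))

last? : (x : Fin (suc m)) → toℕ x < m ⊎ toℕ x ≡ m
last? {m} x with toℕ x Data.Nat.≟ m
... | yes x≡m = inj₂ x≡m
... | no x≢m  = inj₁ (≤∧≢⇒< (toℕ≤pred[n] x) x≢m)

-- i.e. next ∘ opposite, which is x ↦ −x, is an involution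
next-opposite-next : (x : Fin (suc m)) → next (opposite (next x)) ≡ opposite x
next-opposite-next {m} x with last? x
... | inj₁ x<m = toℕ-injective (begin
  toℕ (next (opposite (next x))) ≡⟨ toℕ-next-< _ (subst (_< m) (sym opp) (∸-suc-< x<m)) ⟩
  suc (toℕ (opposite (next x)))  ≡⟨ cong suc opp ⟩
  suc (m ∸ suc (toℕ x))          ≡⟨ suc-∸-suc x<m ⟩
  m ∸ toℕ x                      ≡⟨ sym (opposite-prop x) ⟩
  toℕ (opposite x)               ∎)
  where
  open ≡-Reasoning
  opp : toℕ (opposite (next x)) ≡ m ∸ suc (toℕ x)
  opp = trans (opposite-prop (next x)) (cong (m ∸_) (toℕ-next-< x x<m))
  ∸-suc-< : ∀ {a b} → b < a → a ∸ suc b < a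
  ∸-suc-< {suc a} {b} (s≤s _) = s≤s (m∸n≤m a b)
  suc-∸-suc : ∀ {a b} → b < a → suc (a ∸ suc b) ≡ a ∸ b
  suc-∸-suc {suc a} {zero}  _         = refl
  suc-∸-suc {suc a} {suc b} (s≤s b<a) = suc-∸-suc b<a
... | inj₂ x≡m = toℕ-injective (begin
  toℕ (next (opposite (next x))) ≡⟨ toℕ-next-last _ opp ⟩
  0                              ≡⟨ sym (n∸n≡0 m) ⟩
  m ∸ m                          ≡⟨ cong (m ∸_) (sym x≡m) ⟩
  m ∸ toℕ x                      ≡⟨ sym (opposite-prop x) ⟩
  toℕ (opposite x)               ∎)
  where
  open ≡-Reasoning
  opp : toℕ (opposite (next x)) ≡ m
  opp = trans (opposite-prop (next x)) (cong (m ∸_) (toℕ-next-last x x≡m))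

prev : Fin (suc m) → Fin (suc m)
prev = opposite ∘ next ∘ opposite

prev-next : (x : Fin (suc m)) → prev (next x) ≡ x
prev-next x = trans (cong opposite (next-opposite-next x)) (opposite-involutive x)

next-prev : (x : Fin (suc m)) → next (prev x) ≡ x
next-prev x = trans (next-opposite-next (opposite x)) (opposite-involutive x)

next-injective : {x y : Fin (suc m)} → next x ≡ next y → x ≡ y
next-injective {x = x} {y} eq = trans (sym (prev-next x)) (trans (cong prev eq) (prev-next y))

reflect : Fin (suc m) → Fin (suc m)
reflect = next ∘ opposite

reflect-involutive : (x : Fin (suc m)) → reflect (reflect x) ≡ x
reflect-involutive x = trans (next-opposite-next (opposite x)) (opposite-involutive x)

toℕ-≡ᵇ : ∀ {k} (a b : Fin k) → (toℕ a ≡ᵇ toℕ b) ≡ (a =ᶠ b)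
toℕ-≡ᵇ a b with a ≟ b
... | yes refl = Equivalence.to T-≡ (≡⇒≡ᵇ (toℕ a) (toℕ a) refl)
... | no a≢b with toℕ a ≡ᵇ toℕ b in eq
...   | false = refl
...   | true  = contradiction (toℕ-injective (≡ᵇ⇒≡ (toℕ a) (toℕ b) (subst T (sym eq) _))) a≢b

opaque
  cycle : Graph (suc m)
  cycle {m} = cycleGraph (suc m)

  cycle≗cycleGraph : (x y : Fin (suc m)) → cycle x y ≡ cycleGraph (suc m) x y
  cycle≗cycleGraph x y = refl

  cycle-next : (x y : Fin (suc m)) → cycle x y ≡ (y =ᶠ next x) ∨ (x =ᶠ next y)
  cycle-next {m} x y = cong₂ _∨_ (adjacent-to x y) (adjacent-to y x)
    where
    adjacent-to : (x y : Fin (suc m)) → (toℕ y ≡ᵇ suc (toℕ x) % suc m) ≡ (y =ᶠ next x)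
    adjacent-to x y = trans (cong (toℕ y ≡ᵇ_) (sym (toℕ-next x))) (toℕ-≡ᵇ y (next x))

cycle-sym : (x y : Fin (suc m)) → cycle x y ≡ cycle y x
cycle-sym x y = trans (cycle-next x y) (trans (∨-comm (y =ᶠ next x) (x =ᶠ next y)) (sym (cycle-next y x)))

_~_ : Fin (suc m) → Fin (suc m) → Set
x ~ y = cycle x y ≡ true

~-sym : {x y : Fin (suc m)} → x ~ y → y ~ x
~-sym {x = x} {y} x~y = trans (cycle-sym y x) x~y

~-next : (x : Fin (suc m)) → x ~ next x
~-next x rewrite cycle-next x (next x) | =ᶠ-refl (next x) = refl

~-prev : (x : Fin (suc m)) → x ~ prev x
~-prev x = ~-sym (subst (prev x ~_) (next-prev x) (~-next (prev x)))

~⇒next : {x y : Fin (suc m)} → x ~ y → y ≡ next x ⊎ x ≡ next y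
~⇒next {x = x} {y} x~y with Equivalence.to (T-∨ {y =ᶠ next x}) (subst T (sym (trans (sym (cycle-next x y)) x~y)) _)
... | inj₁ t = inj₁ (=ᶠ⇒≡ t)
... | inj₂ t = inj₂ (=ᶠ⇒≡ t)

nextᴬ : Automorphism (cycle {m})
nextᴬ = record { to = next ; from = prev ; from-to = prev-next ; to-from = next-prev ; preserves = preserves }
  where
  preserves : ∀ a b → cycle (next a) (next b) ≡ cycle a b
  preserves a b = begin
    cycle (next a) (next b)                               ≡⟨ cycle-next (next a) (next b) ⟩
    (next b =ᶠ next (next a)) ∨ (next a =ᶠ next (next b)) ≡⟨ cong₂ _∨_ (=ᶠ-map next-injective b (next a))
                                                                     (=ᶠ-map next-injective a (next b)) ⟩
    (b =ᶠ next a) ∨ (a =ᶠ next b)                         ≡⟨ sym (cycle-next a b) ⟩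
    cycle a b                                             ∎
    where open ≡-Reasoning

reflectionᴬ : Automorphism (cycle {m})
reflectionᴬ = record { to = reflect ; from = reflect ; from-to = reflect-involutive ; to-from = reflect-involutive ; preserves = preserves }
  where
  reflect-injective : ∀ {a b} → reflect a ≡ reflect b → a ≡ b
  reflect-injective {a} {b} eq = trans (sym (reflect-involutive a)) (trans (cong reflect eq) (reflect-involutive b))
  -- the reflection exchanges next and prev
  flipped : ∀ a b → (reflect b =ᶠ next (reflect a)) ≡ (a =ᶠ next b)
  flipped a b = begin
    reflect b =ᶠ next (reflect a)  ≡⟨ cong (reflect b =ᶠ_) (cong next (sym (opposite-involutive (next (opposite a))))) ⟩
    reflect b =ᶠ reflect (prev a)  ≡⟨ =ᶠ-map reflect-injective b (prev a) ⟩
    b =ᶠ prev a                    ≡⟨ sym (=ᶠ-map next-injective b (prev a)) ⟩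
    next b =ᶠ next (prev a)        ≡⟨ cong (next b =ᶠ_) (next-prev a) ⟩
    next b =ᶠ a                    ≡⟨ =ᶠ-sym (next b) a ⟩
    a =ᶠ next b                    ∎
    where open ≡-Reasoning
  preserves : ∀ a b → cycle (reflect a) (reflect b) ≡ cycle a b
  preserves a b = begin
    cycle (reflect a) (reflect b) ≡⟨ cycle-next (reflect a) (reflect b) ⟩
    (reflect b =ᶠ next (reflect a)) ∨ (reflect a =ᶠ next (reflect b)) ≡⟨ cong₂ _∨_ (flipped a b) (flipped b a) ⟩
    (a =ᶠ next b) ∨ (b =ᶠ next a) ≡⟨ ∨-comm (a =ᶠ next b) (b =ᶠ next a) ⟩
    (b =ᶠ next a) ∨ (a =ᶠ next b) ≡⟨ sym (cycle-next a b) ⟩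
    cycle a b                     ∎
    where open ≡-Reasoning

rotation : ℕ → Automorphism (cycle {m})
rotation zero    = idᴬ
rotation (suc k) = nextᴬ ∘ᴬ rotation k

rotate : ℕ → Fin (suc m) → Fin (suc m)
rotate k = Automorphism.to (rotation k)

rotate-+ : (j k : ℕ) (x : Fin (suc m)) → rotate (j + k) x ≡ rotate j (rotate k x)
rotate-+ zero    k x = refl
rotate-+ (suc j) k x = cong next (rotate-+ j k x)

toℕ-rotate-0 : (k : ℕ) → k ≤ m → toℕ (rotate {m} k 0F) ≡ k
toℕ-rotate-0 zero    _   = refl
toℕ-rotate-0 (suc k) k<m = trans (toℕ-next-< _ (subst (_< _) (sym IH) k<m)) (cong suc IH)
  where IH = toℕ-rotate-0 k (<⇒≤ k<m)

rotate-toℕ : (x : Fin (suc m)) → rotate (toℕ x) 0F ≡ x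
rotate-toℕ x = toℕ-injective (toℕ-rotate-0 (toℕ x) (toℕ≤pred[n] x))

-- move x to 0, where toℕ (rotate k 0) = k
rotate-≢ : (k : ℕ) → 1 ≤ k → k ≤ m → (x : Fin (suc m)) → rotate k x ≢ x
rotate-≢ {m} k 1≤k k≤m x fixed = contradiction (trans (sym (toℕ-rotate-0 k k≤m)) (cong toℕ fixes-0)) (m<n⇒n≢0 1≤k)
  where
  a = toℕ x
  fixes-0 : rotate k 0F ≡ 0F
  fixes-0 = Automorphism.to-injective (rotation a) (begin
    rotate a (rotate k 0F) ≡⟨ sym (rotate-+ a k 0F) ⟩
    rotate (a + k) 0F      ≡⟨ cong (λ i → rotate i 0F) (+-comm a k) ⟩
    rotate (k + a) 0F      ≡⟨ rotate-+ k a 0F ⟩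
    rotate k (rotate a 0F) ≡⟨ cong (rotate k) (rotate-toℕ x) ⟩
    rotate k x             ≡⟨ fixed ⟩
    x                      ≡⟨ sym (rotate-toℕ x) ⟩
    rotate a 0F            ∎)
    where open ≡-Reasoning

next-≢ : 1 ≤ m → (x : Fin (suc m)) → next x ≢ x
next-≢ 1≤m = rotate-≢ 1 ≤-refl 1≤m

prev-≢ : 1 ≤ m → (x : Fin (suc m)) → prev x ≢ x
prev-≢ 1≤m x prev-fixed = next-≢ 1≤m x (trans (cong next (sym prev-fixed)) (next-prev x))

next≢prev : 2 ≤ m → (x : Fin (suc m)) → next x ≢ prev x
next≢prev 2≤m x eq = rotate-≢ 2 (s≤s z≤n) 2≤m x (trans (cong next eq) (next-prev x))

triangle-free : 3 ≤ m → {x y z : Fin (suc m)} → x ≢ y → y ≢ z → x ≢ z → x ~ y → y ~ z → x ~ z → ⊥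
triangle-free 3≤m {x} {y} {z} x≢y y≢z x≢z x~y y~z x~z with ~⇒next x~y | ~⇒next y~z | ~⇒next x~z
... | inj₁ refl | inj₁ refl | inj₁ eq   = y≢z (sym eq)
... | inj₁ refl | inj₁ refl | inj₂ eq   = rotate-≢ 3 (s≤s z≤n) 3≤m x (sym eq)
... | inj₁ refl | inj₂ eq   | _         = x≢z (next-injective eq)
... | inj₂ refl | inj₁ eq   | _         = x≢z (sym eq)
... | inj₂ refl | inj₂ refl | inj₁ eq   = rotate-≢ 3 (s≤s z≤n) 3≤m z (sym eq)
... | inj₂ refl | inj₂ refl | inj₂ eq   = x≢y eq

toℕ-prev-0 : toℕ (prev {m} 0F) ≡ m
toℕ-prev-0 {m} = trans (opposite-prop (next (opposite 0F))) (cong (m ∸_) (toℕ-next-last (opposite 0F) (opposite-prop 0F)))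

vertex-view : 1 ≤ m → (x : Fin (suc m)) →
  x ≡ 0F ⊎ x ≡ next 0F ⊎ x ≡ prev 0F ⊎ (2 ≤ toℕ x × toℕ x < m)
vertex-view {m} 1≤m x with toℕ x in eq
... | zero        = inj₁ (toℕ-injective eq)
... | suc zero    = inj₂ (inj₁ (toℕ-injective (trans eq (sym (toℕ-next-< 0F 1≤m)))))
... | suc (suc i) with last? x
...   | inj₁ x<m = inj₂ (inj₂ (inj₂ (s≤s (s≤s z≤n) , subst (_< m) eq x<m)))
...   | inj₂ x≡m = inj₂ (inj₂ (inj₁ (toℕ-injective (trans x≡m (sym toℕ-prev-0)))))

far-from-0 : (j : Fin (suc m)) → 2 ≤ toℕ j → toℕ j < m → cycle 0F j ≡ false
far-from-0 {m} j 2≤j j<m with cycle 0F j in eq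
... | false = refl
... | true with ~⇒next eq
...   | inj₁ j≡next-0 = contradiction (trans (cong toℕ j≡next-0) (toℕ-next-< 0F (<-≤-trans (s≤s z≤n) j<m)))
                          (λ j≡1 → <-irrefl (sym j≡1) 2≤j)
...   | inj₂ 0≡next-j = contradiction (trans (cong toℕ 0≡next-j) (toℕ-next-< j j<m)) λ ()

~⇒≢ : 1 ≤ m → {x y : Fin (suc m)} → x ~ y → x ≢ y
~⇒≢ 1≤m x~y refl with ~⇒next x~y
... | inj₁ eq = next-≢ 1≤m _ (sym eq)
... | inj₂ eq = next-≢ 1≤m _ (sym eq)

rotate-next : (k : ℕ) (y : Fin (suc m)) → rotate k (next y) ≡ next (rotate k y)
rotate-next k y = trans (sym (rotate-+ k 1 y)) (trans (cong (λ i → rotate i y) (+-comm k 1)) (rotate-+ 1 k y))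

rotate-prev : (k : ℕ) (y : Fin (suc m)) → rotate k (prev y) ≡ prev (rotate k y)
rotate-prev k y = begin
  rotate k (prev y)               ≡⟨ sym (prev-next _) ⟩
  prev (next (rotate k (prev y))) ≡⟨ cong prev (sym (rotate-next k (prev y))) ⟩
  prev (rotate k (next (prev y))) ≡⟨ cong (prev ∘ rotate k) (next-prev y) ⟩
  prev (rotate k y)               ∎
  where open ≡-Reasoning

cycle-false : {x y : Fin (suc m)} → ¬ (x ~ y) → cycle x y ≡ false
cycle-false {x = x} {y} x≁y with cycle x y in eq
... | false = refl
... | true  = contradiction refl x≁y

cycle-by-neighbours : 2 ≤ m → {x y : Fin (suc m)} → x ≢ y → cycle x y ≡ (count y (prev x ∷ next x ∷ []) ≡ᵇ 1)
cycle-by-neighbours 2≤m {x} {y} x≢y = by-cases (prev x ≟ y) (next x ≟ y)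
  where
  prev≢next = ≢-sym (next≢prev 2≤m x)
  by-cases : Dec (prev x ≡ y) → Dec (next x ≡ y) → cycle x y ≡ (count y (prev x ∷ next x ∷ []) ≡ᵇ 1)
  by-cases (yes refl) _ =
    trans (~-prev x) (cong (_≡ᵇ 1) (sym
      (trans (count-here (prev x) (next x ∷ [])) (cong suc (count-there {x = prev x} [] (≢-sym prev≢next))))))
  by-cases (no _) (yes refl) =
    trans (~-next x) (cong (_≡ᵇ 1) (sym
      (trans (count-there {x = next x} (next x ∷ []) prev≢next) (count-here (next x) []))))
  by-cases (no p≢y) (no n≢y) =
    trans (cycle-false x≁y) (cong (_≡ᵇ 1) (sym (trans (count-there _ p≢y) (count-there [] n≢y))))
    where
    x≁y : ¬ (x ~ y)
    x≁y x~y with ~⇒next x~y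
    ... | inj₁ y≡next = n≢y (sym y≡next)
    ... | inj₂ x≡next = p≢y (trans (cong prev x≡next) (prev-next y))

path : ℕ → Fin (suc m)
path i = rotate i 0F

toℕ-path : ∀ {i} → i ≤ m → toℕ (path {m} i) ≡ i
toℕ-path {i = i} = toℕ-rotate-0 i

path-injective : ∀ {i j} → i ≤ m → j ≤ m → path {m} i ≡ path j → i ≡ j
path-injective i≤m j≤m eq = trans (sym (toℕ-path i≤m)) (trans (cong toℕ eq) (toℕ-path j≤m))

path-m : path {m} m ≡ prev 0F
path-m = toℕ-injective (trans (toℕ-path ≤-refl) (sym toℕ-prev-0))

reflect-0 : reflect {m} 0F ≡ 0F
reflect-0 = toℕ-injective (toℕ-next-last _ (opposite-prop 0F))

reflect-next-0 : reflect {m} (next 0F) ≡ prev 0F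
reflect-next-0 = trans (next-opposite-next 0F) (toℕ-injective (trans (opposite-prop 0F) (sym toℕ-prev-0)))

-- the 2n symmetries of the cycle
dihedral : Bool → Fin (suc m) → Automorphism (cycle {m})
dihedral true  b = rotation (toℕ b)
dihedral false b = rotation (toℕ b) ∘ᴬ reflectionᴬ

dihedral-0 : (d : Bool) (b : Fin (suc m)) → Automorphism.to (dihedral d b) 0F ≡ b
dihedral-0 true  b = rotate-toℕ b
dihedral-0 false b = trans (cong (rotate (toℕ b)) reflect-0) (rotate-toℕ b)

dihedral-next-0 : (d : Bool) (b : Fin (suc m)) → Automorphism.to (dihedral d b) (next 0F) ≡ (if d then next b else prev b)
dihedral-next-0 true  b = trans (rotate-next (toℕ b) 0F) (cong next (rotate-toℕ b))
dihedral-next-0 false b = trans (cong (rotate (toℕ b)) reflect-next-0) (trans (rotate-prev (toℕ b) 0F) (cong prev (rotate-toℕ b)))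

-- Lower bound and the structure of shortest words

once : ℕ → ℕ
once 1 = 1
once _ = 0

once≤1 : ∀ c → once c ≤ 1
once≤1 0             = z≤n
once≤1 1             = s≤s z≤n
once≤1 (suc (suc c)) = z≤n

once≡1 : ∀ {c} → once c ≡ 1 → c ≡ 1
once≡1 {1} _ = refl

count+once : ∀ c → 1 ≤ c → c + once c ≡ 2 + (c ∸ 2)
count+once 1             _ = refl
count+once (suc (suc c)) _ = cong (suc ∘ suc) (+-identityʳ c)

module _ {m : ℕ} (3≤m : 3 ≤ m) {w : List (Fin (suc m))} (rep : Represents cycle w) where

  no-three-singletons : {a b c : Fin (suc m)} → a ≢ b → b ≢ c → a ≢ c →
    count a w ≡ 1 → count b w ≡ 1 → count c w ≡ 1 → ⊥
  no-three-singletons a≢b b≢c a≢c a-once b-once c-once =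
    triangle-free 3≤m a≢b b≢c a≢c (singletons-adjacent rep a≢b a-once b-once)
      (singletons-adjacent rep b≢c b-once c-once) (singletons-adjacent rep a≢c a-once c-once)

  private
    once≤indicators : {s t : Fin (suc m)} → s ≢ t → count s w ≡ 1 → count t w ≡ 1 →
      ∀ y → once (count y w) ≤ count y (s ∷ []) + count y (t ∷ [])
    once≤indicators {s} {t} s≢t s-once t-once y = by-cases (s ≟ y) (t ≟ y)
      where
      by-cases : Dec (s ≡ y) → Dec (t ≡ y) → once (count y w) ≤ count y (s ∷ []) + count y (t ∷ [])
      by-cases (yes refl) _ = ≤-trans (once≤1 (count y w))
        (subst (λ c → 1 ≤ c + count y (t ∷ [])) (sym (count-here s [])) (m≤m+n 1 _))
      by-cases (no _) (yes refl) = ≤-trans (once≤1 (count y w))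
        (subst (λ c → 1 ≤ count y (s ∷ []) + c) (sym (count-here t [])) (m≤n+m 1 _))
      by-cases (no s≢y) (no t≢y) with count y w in y#
      ... | 0           = z≤n
      ... | suc (suc _) = z≤n
      ... | 1           = ⊥-elim (no-three-singletons s≢t t≢y s≢y s-once t-once y#)

  singletons≤2 : sum (λ y → once (count y w)) ≤ 2
  singletons≤2 with sum (λ y → once (count y w)) ≤? 2
  ... | yes ≤2 = ≤2
  ... | no ≰2 with two-unit-terms (λ y → once (count y w)) (λ y → once≤1 (count y w)) (≤-trans (s≤s (s≤s z≤n)) (≰⇒> ≰2))
  ...   | s , t , s≢t , s-once , t-once = contradiction (begin
      sum (λ y → once (count y w))                         ≤⟨ sum-mono _ _ (once≤indicators s≢t (once≡1 s-once) (once≡1 t-once)) ⟩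
      sum (λ y → count y (s ∷ []) + count y (t ∷ []))      ≡⟨ ∑-distrib-+ (λ y → count y (s ∷ [])) (λ y → count y (t ∷ [])) ⟩
      sum (λ y → count y (s ∷ [])) + sum (λ y → count y (t ∷ [])) ≡⟨ cong₂ _+_ sum-count-[ s ] sum-count-[ t ] ⟩
      2                                                    ∎) ≰2
    where open ≤-Reasoning

  private
    excess = sum (λ y → count y w ∸ 2)
    singletons = sum (λ y → once (count y w))

  length+singletons : length w + singletons ≡ 2 + (m + m) + excess
  length+singletons = begin
    length w + singletons                                  ≡⟨ cong (_+ singletons) (sym (sum-count w)) ⟩
    sum (λ y → count y w) + singletons                     ≡⟨ sym (∑-distrib-+ (λ y → count y w) (λ y → once (count y w))) ⟩
    sum (λ y → count y w + once (count y w))               ≡⟨ sum-cong-≗ (λ y → count+once (count y w) (Represents.occurs rep y)) ⟩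
    sum (λ y → 2 + (count y w ∸ 2))                        ≡⟨ ∑-distrib-+ {suc m} (λ _ → 2) (λ y → count y w ∸ 2) ⟩
    sum {suc m} (λ _ → 2) + excess                         ≡⟨ cong (_+ excess) (trans (sum-const {suc m} 2) (cong (2 +_) m*2≡m+m)) ⟩
    2 + (m + m) + excess                                   ∎
    where
    open ≡-Reasoning
    m*2≡m+m : m * 2 ≡ m + m
    m*2≡m+m = trans (*-comm m 2) (cong (m +_) (+-identityʳ m))

  length-lower-bound : m + m ≤ length w
  length-lower-bound = +-cancelʳ-≤ 2 (m + m) (length w) (begin
    m + m + 2              ≡⟨ +-comm (m + m) 2 ⟩
    2 + (m + m)            ≤⟨ m≤m+n _ excess ⟩
    2 + (m + m) + excess   ≡⟨ sym length+singletons ⟩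
    length w + singletons  ≤⟨ +-monoʳ-≤ (length w) singletons≤2 ⟩
    length w + 2           ∎)
    where open ≤-Reasoning

record Optimal {m : ℕ} (w : List (Fin (suc m))) : Set where
  field
    representation : Represents cycle w
    length≡        : length w ≡ m + m
    count≤2        : ∀ z → count z w ≤ 2
    s t            : Fin (suc m)
    s≢t            : s ≢ t
    s-once         : count s w ≡ 1
    t-once         : count t w ≡ 1

optimal : 3 ≤ m → {w : List (Fin (suc m))} → Represents cycle w → length w ≡ m + m → Optimal w
optimal {m} 3≤m {w} rep |w|≡m+m =
  let s , t , s≢t , s-once , t-once = two-unit-terms (λ y → once (count y w)) (λ y → once≤1 (count y w))
                                        (subst (2 ≤_) (sym singletons≡2+excess) (m≤m+n 2 excess))
  in record
    { representation = rep
    ; length≡ = |w|≡m+m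
    ; count≤2 = λ z → m∸n≡0⇒m≤n (n≤0⇒n≡0 (≤-trans (≤-sum (λ y → count y w ∸ 2) z) excess≤0))
    ; s = s ; t = t ; s≢t = s≢t ; s-once = once≡1 s-once ; t-once = once≡1 t-once
    }
  where
  excess = sum (λ y → count y w ∸ 2)
  singletons = sum (λ y → once (count y w))
  singletons≡2+excess : singletons ≡ 2 + excess
  singletons≡2+excess = +-cancelˡ-≡ (m + m) _ _ (begin
    m + m + singletons     ≡⟨ cong (_+ singletons) (sym |w|≡m+m) ⟩
    length w + singletons  ≡⟨ length+singletons 3≤m rep ⟩
    2 + (m + m) + excess   ≡⟨ cong (_+ excess) (+-comm 2 (m + m)) ⟩
    m + m + 2 + excess     ≡⟨ +-assoc (m + m) 2 excess ⟩
    m + m + (2 + excess)   ∎)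
    where open ≡-Reasoning
  excess≤0 : excess ≤ 0
  excess≤0 = +-cancelˡ-≤ 2 excess 0 (subst (_≤ 2) singletons≡2+excess (singletons≤2 3≤m rep))

Optimal-map : (A : Automorphism (cycle {m})) {w : List (Fin (suc m))} → Optimal w → Optimal (map (Automorphism.to A) w)
Optimal-map A {w} opt = record
  { representation = Represents-map representation
  ; length≡ = trans (length-map to w) length≡
  ; count≤2 = λ z → subst (_≤ 2) (sym (count-map-to z w)) (count≤2 (from z))
  ; s = to s ; t = to t ; s≢t = s≢t ∘ to-injective
  ; s-once = trans (count-map to-injective s w) s-once
  ; t-once = trans (count-map to-injective t w) t-once
  }
  where
  open Optimal opt
  open Automorphism A

module _ {m : ℕ} (3≤m : 3 ≤ m) {w : List (Fin (suc m))} (opt : Optimal w) where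
  open Optimal opt

  once-or-twice : (z : Fin (suc m)) → count z w ≡ 1 ⊎ count z w ≡ 2
  once-or-twice z with count z w | Represents.occurs representation z | count≤2 z
  ... | 1                 | _ | _               = inj₁ refl
  ... | 2                 | _ | _               = inj₂ refl
  ... | suc (suc (suc _)) | _ | s≤s (s≤s ())

  twice-unless-once : (z : Fin (suc m)) → count z w ≢ 1 → count z w ≡ 2
  twice-unless-once z z≢1 = [ (λ z-once → contradiction z-once z≢1) , (λ z-twice → z-twice) ]′ (once-or-twice z)

  once-unless-twice : (z : Fin (suc m)) → count z w ≢ 2 → count z w ≡ 1
  once-unless-twice z z≢2 = [ (λ z-once → z-once) , (λ z-twice → contradiction z-twice z≢2) ]′ (once-or-twice z)

-- Gaps between the two occurrences of a letter

private
  saturated-middle : ∀ a b c → a + (b + c) ≤ 2 → 2 ≤ b → b ≡ 2 × a ≡ 0 × c ≡ 0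
  saturated-middle 0 0 c _ ()
  saturated-middle 0 1 c _ (s≤s ())
  saturated-middle 0 2 0 _ _ = refl , refl , refl
  saturated-middle 0 2 (suc c) (s≤s (s≤s ())) _
  saturated-middle 0 (suc (suc (suc b))) c (s≤s (s≤s ())) _
  saturated-middle (suc a) b c a+b+c<3 2≤b =
    contradiction (≤-trans (s≤s (≤-trans 2≤b (≤-trans (m≤m+n b c) (m≤n+m (b + c) a)))) a+b+c<3) λ { (s≤s (s≤s ())) }

module _ {m : ℕ} (3≤m : 3 ≤ m) {x : Fin (suc m)} {X M Y : List (Fin (suc m))}
         (opt : Optimal (X ++ x ∷ M ++ x ∷ Y))
         (X∌x : count x X ≡ 0) (M∌x : count x M ≡ 0) (Y∌x : count x Y ≡ 0) where
  open Optimal opt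

  cycle-by-gap : (z : Fin (suc m)) → x ≢ z → cycle x z ≡ (count z M ≡ᵇ 1)
  cycle-by-gap z x≢z = trans (Represents.alternation representation x z x≢z)
                             (alternate-around X M Y x≢z X∌x M∌x Y∌x (count≤2 z))

  neighbour-once-in-gap : (z : Fin (suc m)) → x ~ z → count z M ≡ 1
  neighbour-once-in-gap z x~z =
    ≡ᵇ⇒≡ (count z M) 1 (subst T (trans (sym x~z) (cycle-by-gap z (~⇒≢ (3≤⇒1≤ 3≤m) x~z))) _)

module _ {m : ℕ} (3≤m : 3 ≤ m) {x : Fin (suc m)} {X M Y : List (Fin (suc m))}
         (opt : Optimal (X ++ x ∷ M ++ x ∷ Y))
         (X∌x : count x X ≡ 0) (M∌x : count x M ≡ 0) (Y∌x : count x Y ≡ 0) where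
  open Optimal opt

  -- the gap of j lies inside the gap of x, and it contains both neighbours of j
  non-neighbour-in-gap : (j : Fin (suc m)) → x ≢ j → cycle x j ≡ false → 1 ≤ count j M →
    count j M ≡ 2 × (∀ j′ → j ~ j′ → 1 ≤ count j′ M)
  non-neighbour-in-gap j x≢j x≁j j∈M = j-twice , neighbours-in-gap
    where
    j≢once : count j M ≢ 1
    j≢once j-once = contradiction (trans (sym x≁j) (trans (cycle-by-gap 3≤m opt X∌x M∌x Y∌x j x≢j) (cong (_≡ᵇ 1) j-once))) λ ()
    split = saturated-middle _ _ _ (subst (_≤ 2) (count-around X M Y x≢j) (count≤2 j))
              (≤∧≢⇒< j∈M (≢-sym j≢once))
    j-twice = proj₁ split
    neighbours-in-gap : ∀ j′ → j ~ j′ → 1 ≤ count j′ M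
    neighbours-in-gap j′ j~j′ with split-twice j M j-twice
    ... | A , C , D , refl , A∌j , C∌j , D∌j = begin
      1                                      ≡⟨ sym (neighbour-once-in-gap 3≤m opt′ X′∌j C∌j Y′∌j j′ j~j′) ⟩
      count j′ C                             ≤⟨ m≤m+n _ _ ⟩
      count j′ C + count j′ D                ≤⟨ m≤n+m _ (count j′ A) ⟩
      count j′ A + (count j′ C + count j′ D) ≡⟨ sym (count-around A C D (~⇒≢ (3≤⇒1≤ 3≤m) j~j′)) ⟩
      count j′ (A ++ j ∷ C ++ j ∷ D)         ∎
      where
      open ≤-Reasoning
      opt′ = subst Optimal (regroup X A C D Y x j) opt
      X′∌j : count j (X ++ x ∷ A) ≡ 0
      X′∌j = trans (count-++ j X (x ∷ A)) (cong₂ _+_ (proj₁ (proj₂ split)) (trans (count-there A x≢j) A∌j))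
      Y′∌j : count j (D ++ x ∷ Y) ≡ 0
      Y′∌j = trans (count-++ j D (x ∷ Y)) (cong₂ _+_ D∌j (trans (count-there Y x≢j) (proj₂ (proj₂ split))))

-- If a non-neighbour of 0 lay in the gap, then (walking along the path 2, 3, …, m − 1) all of them would,
-- each twice; the two singletons would then be next 0 and prev 0, which are adjacent only in a triangle.
module _ {m : ℕ} (3≤m : 3 ≤ m) {X M Y : List (Fin (suc m))}
         (opt : Optimal (X ++ 0F ∷ M ++ 0F ∷ Y))
         (X∌0 : count 0F X ≡ 0) (M∌0 : count 0F M ≡ 0) (Y∌0 : count 0F Y ≡ 0) where
  open Optimal opt

  private
    w = X ++ 0F ∷ M ++ 0F ∷ Y
    1≤m = 3≤⇒1≤ 3≤m
    2≤m = 3≤⇒2≤ 3≤m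

    Far : Fin (suc m) → Set
    Far j = 2 ≤ toℕ j × toℕ j < m

    non-neighbour-in-gap-0 : ∀ {j} → Far j → 1 ≤ count j M → count j M ≡ 2 × (∀ j′ → j ~ j′ → 1 ≤ count j′ M)
    non-neighbour-in-gap-0 {j} (2≤j , j<m) = non-neighbour-in-gap 3≤m opt X∌0 M∌0 Y∌0 j 0≢j (far-from-0 j 2≤j j<m)
      where
      0≢j : 0F ≢ j
      0≢j refl = contradiction 2≤j λ ()

    far-rotate : ∀ {i} → 2 ≤ i → i < m → Far (rotate i 0F)
    far-rotate {i} 2≤i i<m = subst (2 ≤_) (sym toℕ-i) 2≤i , subst (_< m) (sym toℕ-i) i<m
      where toℕ-i = toℕ-rotate-0 i (<⇒≤ i<m)

    InGap : ℕ → Set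
    InGap i = 1 ≤ count (rotate i 0F) M

    all-far-in-gap : ∀ {y} → Far y → 1 ≤ count y M → ∀ {z} → Far z → 1 ≤ count z M
    all-far-in-gap {y} (2≤y , y<m) y∈M {z} (2≤z , z<m) =
      subst (λ v → 1 ≤ count v M) (rotate-toℕ z)
        (interval-connected InGap up down 2≤y y<m 2≤z z<m (subst (λ v → 1 ≤ count v M) (sym (rotate-toℕ y)) y∈M))
      where
      up : ∀ {i} → 2 ≤ i → suc i < m → InGap i → InGap (suc i)
      up {i} 2≤i i+1<m i∈M = proj₂ (non-neighbour-in-gap-0 (far-rotate 2≤i (<-trans (n<1+n i) i+1<m)) i∈M) _ (~-next _)
      down : ∀ {i} → 2 ≤ i → suc i < m → InGap (suc i) → InGap i
      down {i} 2≤i i+1<m i+1∈M = subst (λ v → 1 ≤ count v M) (prev-next _)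
        (proj₂ (non-neighbour-in-gap-0 (far-rotate (≤-trans 2≤i (n≤1+n i)) i+1<m) i+1∈M) _ (~-prev _))

    single-near-0 : (∀ {z} → Far z → 1 ≤ count z M) → ∀ z → count z w ≡ 1 → z ≡ next 0F ⊎ z ≡ prev 0F
    single-near-0 far∈M z z-once with vertex-view 1≤m z
    ... | inj₁ refl = contradiction (trans (sym z-once) (count-around-self 0F X M Y X∌0 M∌0 Y∌0)) λ ()
    ... | inj₂ (inj₁ z≡next) = inj₁ z≡next
    ... | inj₂ (inj₂ (inj₁ z≡prev)) = inj₂ z≡prev
    ... | inj₂ (inj₂ (inj₂ far)) = contradiction (begin
      2                                      ≡⟨ sym (proj₁ (non-neighbour-in-gap-0 far (far∈M far))) ⟩
      count z M                              ≤⟨ m≤m+n _ _ ⟩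
      count z M + count z Y                  ≤⟨ m≤n+m _ (count z X) ⟩
      count z X + (count z M + count z Y)    ≡⟨ sym (count-around X M Y 0≢z) ⟩
      count z w                              ≡⟨ z-once ⟩
      1                                      ∎) λ { (s≤s ()) }
      where
      open ≤-Reasoning
      0≢z : 0F ≢ z
      0≢z refl = contradiction (proj₁ far) λ ()

    triangle : ¬ (next 0F ~ prev 0F)
    triangle next~prev = triangle-free 3≤m (≢-sym (next-≢ 1≤m 0F)) (next≢prev 2≤m 0F) (≢-sym (prev-≢ 1≤m 0F))
                           (~-next 0F) next~prev (~-prev 0F)

    no-far-in-gap : ∀ {y} → Far y → ¬ (1 ≤ count y M)
    no-far-in-gap far y∈M with single-near-0 (all-far-in-gap far y∈M) s s-once
                             | single-near-0 (all-far-in-gap far y∈M) t t-once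
    ... | inj₁ s≡next | inj₁ t≡next = s≢t (trans s≡next (sym t≡next))
    ... | inj₂ s≡prev | inj₂ t≡prev = s≢t (trans s≡prev (sym t≡prev))
    ... | inj₁ s≡next | inj₂ t≡prev = triangle
            (subst₂ _~_ s≡next t≡prev (singletons-adjacent representation s≢t s-once t-once))
    ... | inj₂ s≡prev | inj₁ t≡next = triangle
            (subst₂ _~_ t≡next s≡prev (singletons-adjacent representation (≢-sym s≢t) t-once s-once))

  gap-at-0 : M ≡ next 0F ∷ prev 0F ∷ [] ⊎ M ≡ prev 0F ∷ next 0F ∷ []
  gap-at-0 = pair-list M (next≢prev 2≤m 0F) over (neighbour-once-in-gap 3≤m opt X∌0 M∌0 Y∌0 _ (~-next 0F))
             (neighbour-once-in-gap 3≤m opt X∌0 M∌0 Y∌0 _ (~-prev 0F))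
    where
    over : Over (next 0F) (prev 0F) M
    over y y∈M with vertex-view 1≤m y
    ... | inj₁ refl = contradiction (≤-trans y∈M (≤-reflexive M∌0)) λ ()
    ... | inj₂ (inj₁ y≡next) = inj₁ y≡next
    ... | inj₂ (inj₂ (inj₁ y≡prev)) = inj₂ y≡prev
    ... | inj₂ (inj₂ (inj₂ far)) = contradiction y∈M (no-far-in-gap far)

-- rotating x to 0 reduces to gap-at-0
gap≡neighbours : 3 ≤ m → {x : Fin (suc m)} {X M Y : List (Fin (suc m))} → Optimal (X ++ x ∷ M ++ x ∷ Y) →
  count x X ≡ 0 → count x M ≡ 0 → count x Y ≡ 0 →
  M ≡ next x ∷ prev x ∷ [] ⊎ M ≡ prev x ∷ next x ∷ []
gap≡neighbours {m} 3≤m {x} {X} {M} {Y} opt X∌x M∌x Y∌x =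
  map-⊎ (λ M₀≡ → trans (restore M₀≡) (cong₂ (λ a b → a ∷ b ∷ []) to-next to-prev))
        (λ M₀≡ → trans (restore M₀≡) (cong₂ (λ a b → a ∷ b ∷ []) to-prev to-next))
        (gap-at-0 3≤m opt₀ (absent X X∌x) (absent M M∌x) (absent Y Y∌x))
  where
  A = rotation (toℕ x)
  open Automorphism A
  x↦0 : from x ≡ 0F
  x↦0 = trans (cong from (sym (rotate-toℕ x))) (from-to 0F)
  opt₀ : Optimal (map from X ++ 0F ∷ map from M ++ 0F ∷ map from Y)
  opt₀ = subst Optimal (trans (map-around from X M Y x) (cong (λ z → map from X ++ z ∷ map from M ++ z ∷ map from Y) x↦0))
               (Optimal-map (A ⁻¹ᴬ) opt)
  absent : (L : List (Fin (suc m))) → count x L ≡ 0 → count 0F (map from L) ≡ 0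
  absent L x∉L = trans (Automorphism.count-map-to (A ⁻¹ᴬ) 0F L) (trans (cong (λ z → count z L) (rotate-toℕ x)) x∉L)
  restore : ∀ {a b} → map from M ≡ a ∷ b ∷ [] → M ≡ to a ∷ to b ∷ []
  restore M₀≡ = trans (sym (map-from-to M)) (cong (map to) M₀≡)
  to-next : to (next 0F) ≡ next x
  to-next = trans (rotate-next (toℕ x) 0F) (cong next (rotate-toℕ x))
  to-prev : to (prev 0F) ≡ prev x
  to-prev = trans (rotate-prev (toℕ x) 0F) (cong prev (rotate-toℕ x))

-- The first two letters of a shortest word

module Head {m : ℕ} (3≤m : 3 ≤ m) {w : List (Fin (suc m))} (opt : Optimal w)
            {a b : Fin (suc m)} {r : List (Fin (suc m))} (w≡ : w ≡ a ∷ b ∷ r) where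
  open Optimal opt

  private
    1≤m = 3≤⇒1≤ 3≤m
    2≤m = 3≤⇒2≤ 3≤m

    -- a once-occurring first letter would have to sit inside the gap of a doubled neighbour
    doubled-neighbour : count a w ≡ 1 → ∀ z → a ~ z → count z w ≡ 2 → ⊥
    doubled-neighbour a-once z a~z z-twice =
      let X , M , Y , w≡X , X∌z , M∌z , Y∌z = split-twice z w z-twice
          a≢z = ~⇒≢ 1≤m a~z
          a∈X = head-in-prefix (b ∷ r) X (M ++ z ∷ Y) (trans (sym w≡) w≡X) a≢z
          a-in-gap = neighbour-once-in-gap 3≤m {z} {X} {M} {Y} (subst Optimal w≡X opt) X∌z M∌z Y∌z a (~-sym a~z)
      in contradiction (begin
        2                                      ≤⟨ +-mono-≤ a∈X (≤-reflexive (sym a-in-gap)) ⟩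
        count a X + count a M                  ≤⟨ +-monoʳ-≤ (count a X) (m≤m+n (count a M) (count a Y)) ⟩
        count a X + (count a M + count a Y)    ≡⟨ sym (count-around X M Y (≢-sym a≢z)) ⟩
        count a (X ++ z ∷ M ++ z ∷ Y)          ≡⟨ cong (count a) (sym w≡X) ⟩
        count a w                              ≡⟨ a-once ⟩
        1                                      ∎) λ { (s≤s ()) }
      where open ≤-Reasoning

  head-twice : count a w ≡ 2
  head-twice = twice-unless-once 3≤m opt a λ a-once →
    neighbours-single a-once (count (next a) w ≟ℕ 1) (count (prev a) w ≟ℕ 1)
    where
    neighbours-single : count a w ≡ 1 → Dec (count (next a) w ≡ 1) → Dec (count (prev a) w ≡ 1) → ⊥
    neighbours-single a-once (yes next-once) (yes prev-once) =
      no-three-singletons 3≤m representation (≢-sym (next-≢ 1≤m a)) (next≢prev 2≤m a) (≢-sym (prev-≢ 1≤m a))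
        a-once next-once prev-once
    neighbours-single a-once (no next≢1) _ =
      doubled-neighbour a-once (next a) (~-next a) (twice-unless-once 3≤m opt (next a) next≢1)
    neighbours-single a-once (yes _) (no prev≢1) =
      doubled-neighbour a-once (prev a) (~-prev a) (twice-unless-once 3≤m opt (prev a) prev≢1)

  head-gap : ∃₂ λ c Y → r ≡ c ∷ a ∷ Y × (b ≡ next a × c ≡ prev a ⊎ b ≡ prev a × c ≡ next a)
  head-gap =
    let X , M , Y , w≡X , X∌a , M∌a , Y∌a = split-twice a w head-twice
        _ , b∷r≡ = first-occurrence-unique [] (b ∷ r) X (M ++ a ∷ Y) (trans (sym w≡) w≡X) refl X∌a
        M-shape = gap≡neighbours 3≤m {a} {X} {M} {Y} (subst Optimal w≡X opt) X∌a M∌a Y∌a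
    in read-off b∷r≡ M-shape
    where
    read-off : ∀ {M Y} → b ∷ r ≡ M ++ a ∷ Y → M ≡ next a ∷ prev a ∷ [] ⊎ M ≡ prev a ∷ next a ∷ [] →
      ∃₂ λ c Y → r ≡ c ∷ a ∷ Y × (b ≡ next a × c ≡ prev a ⊎ b ≡ prev a × c ≡ next a)
    read-off {Y = Y} b∷r≡ (inj₁ refl) = prev a , Y , ∷-injectiveʳ b∷r≡ , inj₁ (∷-injectiveˡ b∷r≡ , refl)
    read-off {Y = Y} b∷r≡ (inj₂ refl) = next a , Y , ∷-injectiveʳ b∷r≡ , inj₂ (∷-injectiveˡ b∷r≡ , refl)

  private
    neighbours-of-a : ∀ {c} → b ≡ next a × c ≡ prev a ⊎ b ≡ prev a × c ≡ next a → a ~ b × a ~ c × b ≢ c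
    neighbours-of-a (inj₁ (refl , refl)) = ~-next a , ~-prev a , next≢prev 2≤m a
    neighbours-of-a (inj₂ (refl , refl)) = ~-prev a , ~-next a , ≢-sym (next≢prev 2≤m a)

    gap-neighbour : ∀ {c} {M Y Z : List (Fin (suc m))} → M ++ b ∷ Y ≡ c ∷ Z →
      M ≡ next b ∷ prev b ∷ [] ⊎ M ≡ prev b ∷ next b ∷ [] → b ~ c
    gap-neighbour eq (inj₁ refl) = subst (b ~_) (∷-injectiveˡ eq) (~-next b)
    gap-neighbour eq (inj₂ refl) = subst (b ~_) (∷-injectiveˡ eq) (~-prev b)

  -- a doubled second letter would have the third letter in its gap, closing a triangle with a
  second-once : count b w ≡ 1
  second-once = once-unless-twice 3≤m opt b λ b-twice →
    let c , Y₀ , r≡ , shape = head-gap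
        X , M , Y , w≡X , X∌b , M∌b , Y∌b = split-twice b w b-twice
        a~b , a~c , b≢c = neighbours-of-a shape
        _ , c∷a∷Y₀≡ = first-occurrence-unique (a ∷ []) (c ∷ a ∷ Y₀) X (M ++ b ∷ Y)
                        (trans (sym (trans w≡ (cong (λ v → a ∷ b ∷ v) r≡))) w≡X) (count-there [] (~⇒≢ 1≤m a~b)) X∌b
        b~c = gap-neighbour (sym c∷a∷Y₀≡) (gap≡neighbours 3≤m {b} {X} {M} {Y} (subst Optimal w≡X opt) X∌b M∌b Y∌b)
    in triangle-free 3≤m (~⇒≢ 1≤m a~b) b≢c (~⇒≢ 1≤m a~c) a~b b~c a~c

  head-adjacent : a ≡ next b ⊎ a ≡ prev b
  head-adjacent = from-shape (proj₂ (proj₂ (proj₂ head-gap)))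
    where
    from-shape : ∀ {c} → b ≡ next a × c ≡ prev a ⊎ b ≡ prev a × c ≡ next a → a ≡ next b ⊎ a ≡ prev b
    from-shape (inj₁ (b≡next , _)) = inj₂ (trans (sym (prev-next a)) (cong prev (sym b≡next)))
    from-shape (inj₂ (b≡prev , _)) = inj₁ (trans (sym (next-prev a)) (cong next (sym b≡prev)))

-- The canonical word

canonical : (m : ℕ) → List (Fin (suc m))
canonical m = zigzag path m

canonical-head : 1 ≤ m → ∃ λ rest → canonical m ≡ next 0F ∷ 0F ∷ rest
canonical-head {suc m} _ = zigzag (path ∘ suc) m , refl

count-canonical-first : 1 ≤ m → count 0F (canonical m) ≡ 1
count-canonical-first {suc m} 1≤m = begin
  count 0F (next 0F ∷ 0F ∷ zigzag (path ∘ suc) m)  ≡⟨ count-there _ (next-≢ 1≤m 0F) ⟩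
  count 0F (0F ∷ zigzag (path ∘ suc) m)            ≡⟨ count-here 0F (zigzag (path ∘ suc) m) ⟩
  suc (count 0F (zigzag (path ∘ suc) m))           ≡⟨ cong suc (count-zigzag-absent (path ∘ suc) 0F m λ i i≤m eq →
                                                        contradiction (path-injective (s≤s i≤m) z≤n eq) λ ()) ⟩
  1                                                ∎
  where open ≡-Reasoning

count-canonical-last : 1 ≤ m → count (path m) (canonical m) ≡ 1
count-canonical-last {suc m} _ = begin
  count x (zigzag path (suc m))                       ≡⟨ cong (count x) (zigzag-snoc path m) ⟩
  count x (zigzag path m ++ x ∷ path m ∷ [])          ≡⟨ count-++ x (zigzag path m) _ ⟩
  count x (zigzag path m) + count x (x ∷ path m ∷ []) ≡⟨ cong₂ _+_ prefix-absent (count-here x _) ⟩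
  suc (count x (path m ∷ []))                         ≡⟨ cong suc (count-there [] (λ eq → <-irrefl (path-injective (n≤1+n m) ≤-refl eq) ≤-refl)) ⟩
  1                                                   ∎
  where
  open ≡-Reasoning
  x = path {suc m} (suc m)
  prefix-absent : count x (zigzag path m) ≡ 0
  prefix-absent = count-zigzag-absent path x m λ i i≤m eq →
    <-irrefl (path-injective (≤-trans i≤m (n≤1+n m)) ≤-refl eq) (s≤s i≤m)

module Canonical {m : ℕ} (3≤m : 3 ≤ m) where

  private
    1≤m = 3≤⇒1≤ 3≤m
    2≤m = 3≤⇒2≤ 3≤m
    W = canonical m

  inner-decomposition : ∀ {j} → suc j < m → ∃ λ Y →
    W ≡ zigzag path j ++ path (suc j) ∷ (path j ∷ path (suc (suc j)) ∷ []) ++ path (suc j) ∷ Y ×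
    count (path (suc j)) (zigzag path j) ≡ 0 × count (path (suc j)) (path j ∷ path (suc (suc j)) ∷ []) ≡ 0 ×
    count (path (suc j)) Y ≡ 0
  inner-decomposition {j} j+1<m = Y , W≡ , X∌x , M∌x , Y∌x
    where
    l = m ∸ suc (suc j)
    x = path {m} (suc j)
    Y = zigzag (λ i → path (suc (suc j) + i)) l
    j+2+l≡m : suc (suc j) + l ≡ m
    j+2+l≡m = m+[n∸m]≡n j+1<m
    injective : ∀ {a b} → a ≤ m → b ≤ m → a ≢ b → path {m} a ≢ path b
    injective a≤m b≤m a≢b eq = a≢b (path-injective a≤m b≤m eq)
    W≡ : W ≡ zigzag path j ++ x ∷ (path j ∷ path (suc (suc j)) ∷ []) ++ x ∷ Y
    W≡ = begin
      zigzag path m                                            ≡⟨ cong (zigzag path) (sym j+2+l≡m) ⟩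
      zigzag path (suc (suc j) + l)                            ≡⟨ zigzag-++ path (suc (suc j)) l ⟩
      zigzag path (suc (suc j)) ++ Y                           ≡⟨ cong (_++ Y) (zigzag-snoc path (suc j)) ⟩
      (zigzag path (suc j) ++ path (suc (suc j)) ∷ x ∷ []) ++ Y ≡⟨ cong (λ v → (v ++ path (suc (suc j)) ∷ x ∷ []) ++ Y) (zigzag-snoc path j) ⟩
      ((zigzag path j ++ x ∷ path j ∷ []) ++ path (suc (suc j)) ∷ x ∷ []) ++ Y
        ≡⟨ cong (_++ Y) (++-assoc (zigzag path j) (x ∷ path j ∷ []) _) ⟩
      (zigzag path j ++ x ∷ path j ∷ path (suc (suc j)) ∷ x ∷ []) ++ Y
        ≡⟨ ++-assoc (zigzag path j) _ Y ⟩
      zigzag path j ++ x ∷ (path j ∷ path (suc (suc j)) ∷ []) ++ x ∷ Y ∎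
      where open ≡-Reasoning
    X∌x = count-zigzag-absent path x j λ i i≤j →
      injective (≤-trans i≤j (≤-trans (n≤1+n j) (<⇒≤ j+1<m))) (<⇒≤ j+1<m) (<⇒≢ (s≤s i≤j))
    M∌x = trans (count-there _ (injective (≤-trans (n≤1+n j) (<⇒≤ j+1<m)) (<⇒≤ j+1<m) (<⇒≢ (n<1+n j))))
                (count-there [] (injective j+1<m (<⇒≤ j+1<m) (≢-sym (<⇒≢ (n<1+n (suc j))))))
    Y∌x = count-zigzag-absent (λ i → path (suc (suc j) + i)) x l λ i i≤l →
      injective (subst (suc (suc j) + i ≤_) j+2+l≡m (+-monoʳ-≤ (suc (suc j)) i≤l)) (<⇒≤ j+1<m)
        (≢-sym (<⇒≢ (≤-trans (n<1+n (suc j)) (m≤m+n (suc (suc j)) i))))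

  path-view : (z : Fin (suc m)) → z ≡ path 0 ⊎ z ≡ path m ⊎ ∃ λ j → suc j < m × z ≡ path (suc j)
  path-view z = by-toℕ (toℕ z) refl (last? z)
    where
    by-toℕ : ∀ i → toℕ z ≡ i → toℕ z < m ⊎ toℕ z ≡ m → z ≡ path 0 ⊎ z ≡ path m ⊎ ∃ λ j → suc j < m × z ≡ path (suc j)
    by-toℕ zero    z≡i _          = inj₁ (trans (sym (rotate-toℕ z)) (cong path z≡i))
    by-toℕ (suc j) z≡i (inj₁ z<m) = inj₂ (inj₂ (j , subst (_< m) z≡i z<m , trans (sym (rotate-toℕ z)) (cong path z≡i)))
    by-toℕ (suc j) _   (inj₂ z≡m) = inj₂ (inj₁ (trans (sym (rotate-toℕ z)) (cong path z≡m)))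

  inner-twice : ∀ {j} → suc j < m → count (path (suc j)) W ≡ 2
  inner-twice {j} j+1<m = let Y , W≡ , X∌x , M∌x , Y∌x = inner-decomposition j+1<m in
    trans (cong (count _) W≡)
      (count-around-self (path (suc j)) (zigzag path j) (path j ∷ path (suc (suc j)) ∷ []) Y X∌x M∌x Y∌x)

  count-bounds : ∀ z → 1 ≤ count z W × count z W ≤ 2
  count-bounds z = bounds (by-path-view z)
    where
    by-path-view : ∀ z → count z W ≡ 1 ⊎ count z W ≡ 2
    by-path-view z with path-view z
    ... | inj₁ refl                      = inj₁ (count-canonical-first 1≤m)
    ... | inj₂ (inj₁ refl)               = inj₁ (count-canonical-last 1≤m)
    ... | inj₂ (inj₂ (j , j+1<m , refl)) = inj₂ (inner-twice j+1<m)
    bounds : ∀ {c} → c ≡ 1 ⊎ c ≡ 2 → 1 ≤ c × c ≤ 2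
    bounds (inj₁ refl) = s≤s z≤n , s≤s z≤n
    bounds (inj₂ refl) = s≤s z≤n , s≤s (s≤s z≤n)

  inner-alternation : ∀ {j} → suc j < m → ∀ y → path (suc j) ≢ y → cycle (path (suc j)) y ≡ alternate (path (suc j)) y W
  inner-alternation {j} j+1<m y x≢y = begin
    cycle x y                                           ≡⟨ cycle-by-neighbours 2≤m x≢y ⟩
    (count y (prev x ∷ next x ∷ []) ≡ᵇ 1)               ≡⟨ cong (λ v → count y (v ∷ next x ∷ []) ≡ᵇ 1) (prev-next (path j)) ⟩
    (count y (path j ∷ path (suc (suc j)) ∷ []) ≡ᵇ 1)
      ≡⟨ sym (alternate-around (zigzag path j) (path j ∷ path (suc (suc j)) ∷ []) Y x≢y X∌x M∌x Y∌x
                (subst (λ v → count y v ≤ 2) W≡ (proj₂ (count-bounds y)))) ⟩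
    alternate x y (zigzag path j ++ x ∷ (path j ∷ path (suc (suc j)) ∷ []) ++ x ∷ Y) ≡⟨ cong (alternate x y) (sym W≡) ⟩
    alternate x y W                                     ∎
    where
    open ≡-Reasoning
    x = path {m} (suc j)
    decomposition = inner-decomposition j+1<m
    Y = proj₁ decomposition
    W≡ = proj₁ (proj₂ decomposition)
    X∌x = proj₁ (proj₂ (proj₂ decomposition))
    M∌x = proj₁ (proj₂ (proj₂ (proj₂ decomposition)))
    Y∌x = proj₂ (proj₂ (proj₂ (proj₂ decomposition)))

  canonical-represents : Represents cycle W
  canonical-represents = record { occurs = proj₁ ∘ count-bounds ; alternation = alternation }
    where
    0~m : 0F ~ path m
    0~m = subst (0F ~_) (sym path-m) (~-prev 0F)
    alternation : ∀ x y → x ≢ y → cycle x y ≡ alternate x y W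
    alternation x y x≢y with path-view x | path-view y
    ... | inj₂ (inj₂ (j , j+1<m , refl)) | _ = inner-alternation j+1<m y x≢y
    ... | inj₁ _ | inj₂ (inj₂ (j , j+1<m , refl)) =
      trans (cycle-sym x _) (trans (inner-alternation j+1<m x (≢-sym x≢y)) (alternate-comm _ x W))
    ... | inj₂ (inj₁ _) | inj₂ (inj₂ (j , j+1<m , refl)) =
      trans (cycle-sym x _) (trans (inner-alternation j+1<m x (≢-sym x≢y)) (alternate-comm _ x W))
    ... | inj₁ refl | inj₁ refl = contradiction refl x≢y
    ... | inj₂ (inj₁ refl) | inj₂ (inj₁ refl) = contradiction refl x≢y
    ... | inj₁ refl | inj₂ (inj₁ refl) =
      trans 0~m (sym (alternate-once W x≢y (count-canonical-first 1≤m) (count-canonical-last 1≤m)))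
    ... | inj₂ (inj₁ refl) | inj₁ refl =
      trans (~-sym 0~m) (sym (alternate-once W x≢y (count-canonical-last 1≤m) (count-canonical-first 1≤m)))

-- Classification

module Normalised {m : ℕ} (3≤m : 3 ≤ m) {w : List (Fin (suc m))} (opt : Optimal w)
                  {r : List (Fin (suc m))} (w≡ : w ≡ next 0F ∷ 0F ∷ r) where
  open Optimal opt

  private
    1≤m = 3≤⇒1≤ 3≤m
    2≤m = 3≤⇒2≤ 3≤m

    0-once : count 0F w ≡ 1
    0-once = Head.second-once 3≤m opt w≡

    -- the singleton other than 0 is adjacent to 0 but is not the doubled first letter
    prev-0-once : count (prev 0F) w ≡ 1
    prev-0-once = other-singleton (s ≟ 0F)
      where
      near-0 : ∀ {u} → u ≢ 0F → count u w ≡ 1 → count (prev 0F) w ≡ 1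
      near-0 {u} u≢0 u-once = by-adjacency (~⇒next (singletons-adjacent representation (≢-sym u≢0) 0-once u-once))
        where
        by-adjacency : u ≡ next 0F ⊎ 0F ≡ next u → count (prev 0F) w ≡ 1
        by-adjacency (inj₁ u≡next) =
          contradiction (trans (sym u-once) (trans (cong (λ v → count v w) u≡next) (Head.head-twice 3≤m opt w≡))) λ ()
        by-adjacency (inj₂ 0≡next-u) = subst (λ v → count v w ≡ 1) (trans (sym (prev-next u)) (cong prev (sym 0≡next-u))) u-once
      other-singleton : Dec (s ≡ 0F) → count (prev 0F) w ≡ 1
      other-singleton (yes s≡0) = near-0 (λ t≡0 → s≢t (trans s≡0 (sym t≡0))) t-once
      other-singleton (no s≢0)  = near-0 s≢0 s-once

    inner-twice : ∀ {i} → 1 ≤ i → i < m → count (path i) w ≡ 2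
    inner-twice {i} 1≤i i<m = twice-unless-once 3≤m opt (path i) λ i-once →
      no-three-singletons 3≤m representation 0≢prev-0 prev-0≢i 0≢i 0-once prev-0-once i-once
      where
      toℕ-i = toℕ-path (<⇒≤ i<m)
      0≢prev-0 : 0F ≢ prev 0F
      0≢prev-0 = ≢-sym (prev-≢ 1≤m 0F)
      prev-0≢i : prev 0F ≢ path i
      prev-0≢i eq = <-irrefl (trans (sym toℕ-i) (trans (cong toℕ (sym eq)) toℕ-prev-0)) i<m
      0≢i : 0F ≢ path i
      0≢i eq = contradiction (trans (sym toℕ-i) (cong toℕ (sym eq))) (m<n⇒n≢0 1≤i)

    -- the second occurrence of path (1 + j) closes its gap, which must be [path j, path (2 + j)]
    module Step (j : ℕ) (r′ : List (Fin (suc m))) (j+1<m : suc j < m) (w≡r′ : w ≡ zigzag path (suc j) ++ r′) where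
      x : Fin (suc m)
      x = path (suc j)
      zz : List (Fin (suc m))
      zz = zigzag path j

      w≡′ : w ≡ zz ++ x ∷ path j ∷ r′
      w≡′ = trans w≡r′ (trans (cong (_++ r′) (zigzag-snoc path j)) (++-assoc zz _ _))

      pj≢x : path j ≢ x
      pj≢x eq = contradiction (path-injective (≤-trans (n≤1+n j) (<⇒≤ j+1<m)) (<⇒≤ j+1<m) eq) (<⇒≢ (n<1+n j))

      zz∌x : count x zz ≡ 0
      zz∌x = count-zigzag-absent path x j λ i i≤j eq →
        <-irrefl (path-injective (≤-trans i≤j (≤-trans (n≤1+n j) (<⇒≤ j+1<m))) (<⇒≤ j+1<m) eq) (s≤s i≤j)

      x-once-in-r′ : count x r′ ≡ 1
      x-once-in-r′ = suc-injective (begin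
        suc (count x r′)                       ≡⟨ cong suc (sym (count-there r′ pj≢x)) ⟩
        suc (count x (path j ∷ r′))            ≡⟨ sym (count-here x _) ⟩
        count x (x ∷ path j ∷ r′)              ≡⟨ cong (_+ count x (x ∷ path j ∷ r′)) (sym zz∌x) ⟩
        count x zz + count x (x ∷ path j ∷ r′) ≡⟨ sym (count-++ x zz _) ⟩
        count x (zz ++ x ∷ path j ∷ r′)        ≡⟨ cong (count x) (sym w≡′) ⟩
        count x w                              ≡⟨ inner-twice (s≤s z≤n) j+1<m ⟩
        2                                      ∎)
        where open ≡-Reasoning

      next-pair : ∃ λ r″ → r′ ≡ path (suc (suc j)) ∷ path (suc j) ∷ r″
      next-pair = close (split-first x r′ (subst (1 ≤_) (sym x-once-in-r′) (s≤s z≤n)))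
        where
        close : (∃₂ λ R₁ R₂ → r′ ≡ R₁ ++ x ∷ R₂ × count x R₁ ≡ 0 × suc (count x R₂) ≡ count x r′) →
                ∃ λ r″ → r′ ≡ path (suc (suc j)) ∷ path (suc j) ∷ r″
        close (R₁ , R₂ , r′≡ , R₁∌x , R₂#) =
          by-gap (gap≡neighbours 3≤m {x} {zz} {path j ∷ R₁} {R₂} (subst Optimal w≡″ opt)
                    zz∌x (trans (count-there R₁ pj≢x) R₁∌x) (suc-injective (trans R₂# x-once-in-r′)))
          where
          w≡″ : w ≡ zz ++ x ∷ (path j ∷ R₁) ++ x ∷ R₂
          w≡″ = trans w≡′ (cong (λ v → zz ++ x ∷ path j ∷ v) r′≡)
          by-gap : path j ∷ R₁ ≡ next x ∷ prev x ∷ [] ⊎ path j ∷ R₁ ≡ prev x ∷ next x ∷ [] →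
                   ∃ λ r″ → r′ ≡ path (suc (suc j)) ∷ path (suc j) ∷ r″
          by-gap (inj₁ pj∷R₁≡) = contradiction (sym (∷-injectiveˡ pj∷R₁≡)) (rotate-≢ 2 (s≤s z≤n) 2≤m (path j))
          by-gap (inj₂ pj∷R₁≡) = R₂ , trans r′≡ (cong (_++ x ∷ R₂) (∷-injectiveʳ pj∷R₁≡))

    prefix : ∀ j → suc j ≤ m → ∃ λ r′ → w ≡ zigzag path (suc j) ++ r′
    prefix zero    _     = r , w≡
    prefix (suc j) j+2≤m = extend (prefix j (<⇒≤ j+2≤m))
      where
      extend : (∃ λ r′ → w ≡ zigzag path (suc j) ++ r′) → ∃ λ r″ → w ≡ zigzag path (suc (suc j)) ++ r″
      extend (r′ , w≡r′) = let r″ , r′≡ = Step.next-pair j r′ j+2≤m w≡r′ in r″ , (begin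
        w                                                                     ≡⟨ trans w≡r′ (cong (zigzag path (suc j) ++_) r′≡) ⟩
        zigzag path (suc j) ++ path (suc (suc j)) ∷ path (suc j) ∷ r″         ≡⟨ sym (++-assoc (zigzag path (suc j)) _ r″) ⟩
        (zigzag path (suc j) ++ path (suc (suc j)) ∷ path (suc j) ∷ []) ++ r″ ≡⟨ cong (_++ r″) (sym (zigzag-snoc path (suc j))) ⟩
        zigzag path (suc (suc j)) ++ r″                                       ∎)
        where open ≡-Reasoning

  normalised-canonical : w ≡ canonical m
  normalised-canonical = trans w≡′ (trans (cong (zigzag path m ++_) r′≡[]) (++-identityʳ (zigzag path m)))
    where
    m-1+1 = 1+[m∸1]≡m 1≤m
    r′ = proj₁ (prefix (m ∸ 1) (≤-reflexive m-1+1))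
    w≡′ : w ≡ zigzag path m ++ r′
    w≡′ = subst (λ l → w ≡ zigzag path l ++ r′) m-1+1 (proj₂ (prefix (m ∸ 1) (≤-reflexive m-1+1)))
    r′≡[] : r′ ≡ []
    r′≡[] = length-0 (+-cancelˡ-≡ (m + m) _ _ (begin
      m + m + length r′                   ≡⟨ cong (_+ length r′) (sym (length-zigzag path m)) ⟩
      length (zigzag path m) + length r′  ≡⟨ sym (length-++ (zigzag path m)) ⟩
      length (zigzag path m ++ r′)        ≡⟨ cong length (sym w≡′) ⟩
      length w                            ≡⟨ length≡ ⟩
      m + m                               ≡⟨ sym (+-identityʳ (m + m)) ⟩
      m + m + 0                           ∎))
      where
      open ≡-Reasoning
      length-0 : ∀ {l : List (Fin (suc m))} → length l ≡ 0 → l ≡ []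
      length-0 {[]} _ = refl

family : Bool → Fin (suc m) → List (Fin (suc m))
family {m} d b = map (Automorphism.to (dihedral d b)) (canonical m)

decode : List (Fin (suc m)) → Bool × Fin (suc m)
decode (a ∷ b ∷ _) = a =ᶠ next b , b
decode _           = true , 0F

decode-family : 2 ≤ m → (d : Bool) (b : Fin (suc m)) → decode (family d b) ≡ (d , b)
decode-family 2≤m d b = begin
  decode (family d b)                                ≡⟨ cong (decode ∘ map to) (proj₂ (canonical-head (≤-trans (s≤s z≤n) 2≤m))) ⟩
  (to (next 0F) =ᶠ next (to 0F) , to 0F)             ≡⟨ cong₂ (λ a b′ → a =ᶠ next b′ , b′) (dihedral-next-0 d b) (dihedral-0 d b) ⟩
  ((if d then next b else prev b) =ᶠ next b , b)      ≡⟨ cong (_, b) (orientation d) ⟩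
  (d , b)                                            ∎
  where
  open ≡-Reasoning
  open Automorphism (dihedral d b)
  orientation : ∀ d → ((if d then next b else prev b) =ᶠ next b) ≡ d
  orientation true  = =ᶠ-refl (next b)
  orientation false = =ᶠ-≢ (≢-sym (next≢prev 2≤m b))

classify : 3 ≤ m → {w : List (Fin (suc m))} → Optimal w → w ≡ family (proj₁ (decode w)) (proj₂ (decode w))
classify 3≤m {[]} opt = contradiction (Optimal.length≡ opt) (<⇒≢ (≤-trans (s≤s z≤n) (+-mono-≤ 3≤m z≤n)))
classify 3≤m {a ∷ []} opt = contradiction (Optimal.length≡ opt) (<⇒≢ (≤-trans (s≤s (s≤s z≤n)) (+-mono-≤ 3≤m z≤n)))
classify {m} 3≤m {a ∷ b ∷ r} opt = begin
  a ∷ b ∷ r                       ≡⟨ sym (map-from-to (a ∷ b ∷ r)) ⟩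
  map to (map from (a ∷ b ∷ r))   ≡⟨ cong (map to) (Normalised.normalised-canonical 3≤m (Optimal-map (A ⁻¹ᴬ) opt) w₀≡) ⟩
  map to (canonical m)            ∎
  where
  open ≡-Reasoning
  d = a =ᶠ next b
  A = dihedral d b
  open Automorphism A
  2≤m = 3≤⇒2≤ 3≤m
  orientation : a ≡ next b ⊎ a ≡ prev b → (if (a =ᶠ next b) then next b else prev b) ≡ a
  orientation (inj₁ refl) rewrite =ᶠ-refl (next b) = refl
  orientation (inj₂ refl) rewrite =ᶠ-≢ (≢-sym (next≢prev 2≤m b)) = refl
  a↦ : from a ≡ next 0F
  a↦ = trans (cong from (sym (trans (dihedral-next-0 d b) (orientation (Head.head-adjacent 3≤m opt refl))))) (from-to (next 0F))
  b↦ : from b ≡ 0F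
  b↦ = trans (cong from (sym (dihedral-0 d b))) (from-to 0F)
  w₀≡ : map from (a ∷ b ∷ r) ≡ next 0F ∷ 0F ∷ map from r
  w₀≡ = cong₂ (λ a′ b′ → a′ ∷ b′ ∷ map from r) a↦ b↦

Words : (n L : ℕ) → Set
Words n L = Σ (Vec (Fin n) L) (λ v → T (represents (cycleGraph n) (toList v)))

represents⇔Represents-cycle : (w : List (Fin (suc m))) → T (represents (cycleGraph (suc m)) w) ⇔ Represents cycle w
represents⇔Represents-cycle w = mk⇔
  (Represents-≗ (λ x y → sym (cycle≗cycleGraph x y)) ∘ Equivalence.to (represents⇔Represents _ w))
  (Equivalence.from (represents⇔Represents _ w) ∘ Represents-≗ cycle≗cycleGraph)

toList-cast-fromList : {A : Set} {L : ℕ} (l : List A) (eq : length l ≡ L) → toList (cast eq (fromList l)) ≡ l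
toList-cast-fromList l eq = trans (toList-cast eq (fromList l)) (toList∘fromList l)

module _ {m : ℕ} (3≤m : 3 ≤ m) where

  private
    family-length : (d : Bool) (b : Fin (suc m)) → length (family d b) ≡ m + m
    family-length d b = trans (length-map _ (canonical m)) (length-zigzag path m)

    family-represents : (d : Bool) (b : Fin (suc m)) → T (represents (cycleGraph (suc m)) (family d b))
    family-represents d b = Equivalence.from (represents⇔Represents-cycle (family d b))
      (Automorphism.Represents-map (dihedral d b) (Canonical.canonical-represents 3≤m))

    word : Bool × Fin (suc m) → Words (suc m) (m + m)
    word (d , b) = cast (family-length d b) (fromList (family d b))
                 , subst (T ∘ represents (cycleGraph (suc m))) (sym (toList-cast-fromList (family d b) (family-length d b)))
                         (family-represents d b)

    word-≡ : {v v′ : Vec (Fin (suc m)) (m + m)} {p : T (represents (cycleGraph (suc m)) (toList v))}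
             {p′ : T (represents (cycleGraph (suc m)) (toList v′))} → v ≡ v′ → (v , p) ≡ (v′ , p′)
    word-≡ {p = p} {p′} refl = cong (_ ,_) (T-irrelevant p p′)

    word-decode : ∀ (x : Words (suc m) (m + m)) → word (decode (toList (proj₁ x))) ≡ x
    word-decode (v , p) = word-≡ (trans (sym (cast-is-id refl v′)) (toList-injective refl v′ v
                            (trans (toList-cast-fromList (family d b) (family-length d b)) (sym (classify 3≤m opt)))))
      where
      d = proj₁ (decode (toList v))
      b = proj₂ (decode (toList v))
      v′ = proj₁ (word (d , b))
      opt = optimal 3≤m (Equivalence.to (represents⇔Represents-cycle (toList v)) p) (length-toList v)

    decode-word : ∀ x → decode (toList (proj₁ (word x))) ≡ x
    decode-word (d , b) = trans (cong decode (toList-cast-fromList (family d b) (family-length d b)))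
                                (decode-family (3≤⇒2≤ 3≤m) d b)

  words↔ : (Bool × Fin (suc m)) ↔ Words (suc m) (m + m)
  words↔ = mk↔ₛ′ word (decode ∘ toList ∘ proj₁) word-decode decode-word

  shortest-length : IsMinReprLength (cycleGraph (suc m)) (m + m)
  shortest-length = word (true , 0F) , λ w t →
    length-lower-bound 3≤m (Equivalence.to (represents⇔Represents-cycle w) t)

-- The triangle

triangle-word : Fin 6 → Words 3 3
triangle-word 0F = (0F ∷ 1F ∷ 2F ∷ []) , _
triangle-word 1F = (0F ∷ 2F ∷ 1F ∷ []) , _
triangle-word 2F = (1F ∷ 0F ∷ 2F ∷ []) , _
triangle-word 3F = (1F ∷ 2F ∷ 0F ∷ []) , _
triangle-word 4F = (2F ∷ 0F ∷ 1F ∷ []) , _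
triangle-word 5F = (2F ∷ 1F ∷ 0F ∷ []) , _

triangle-index : Vec (Fin 3) 3 → Fin 6
triangle-index (0F ∷ 1F ∷ 2F ∷ []) = 0F
triangle-index (0F ∷ 2F ∷ 1F ∷ []) = 1F
triangle-index (1F ∷ 0F ∷ 2F ∷ []) = 2F
triangle-index (1F ∷ 2F ∷ 0F ∷ []) = 3F
triangle-index (2F ∷ 0F ∷ 1F ∷ []) = 4F
triangle-index (2F ∷ 1F ∷ 0F ∷ []) = 5F
triangle-index _                   = 0F

-- a word of length 3 represents the triangle only if it is a permutation
triangle-word-index : ∀ (x : Words 3 3) → triangle-word (triangle-index (proj₁ x)) ≡ x
triangle-word-index ((0F ∷ 0F ∷ 0F ∷ []) , ())
triangle-word-index ((0F ∷ 0F ∷ 1F ∷ []) , ())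
triangle-word-index ((0F ∷ 0F ∷ 2F ∷ []) , ())
triangle-word-index ((0F ∷ 1F ∷ 0F ∷ []) , ())
triangle-word-index ((0F ∷ 1F ∷ 1F ∷ []) , ())
triangle-word-index ((0F ∷ 1F ∷ 2F ∷ []) , _) = refl
triangle-word-index ((0F ∷ 2F ∷ 0F ∷ []) , ())
triangle-word-index ((0F ∷ 2F ∷ 1F ∷ []) , _) = refl
triangle-word-index ((0F ∷ 2F ∷ 2F ∷ []) , ())
triangle-word-index ((1F ∷ 0F ∷ 0F ∷ []) , ())
triangle-word-index ((1F ∷ 0F ∷ 1F ∷ []) , ())
triangle-word-index ((1F ∷ 0F ∷ 2F ∷ []) , _) = refl
triangle-word-index ((1F ∷ 1F ∷ 0F ∷ []) , ())
triangle-word-index ((1F ∷ 1F ∷ 1F ∷ []) , ())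
triangle-word-index ((1F ∷ 1F ∷ 2F ∷ []) , ())
triangle-word-index ((1F ∷ 2F ∷ 0F ∷ []) , _) = refl
triangle-word-index ((1F ∷ 2F ∷ 1F ∷ []) , ())
triangle-word-index ((1F ∷ 2F ∷ 2F ∷ []) , ())
triangle-word-index ((2F ∷ 0F ∷ 0F ∷ []) , ())
triangle-word-index ((2F ∷ 0F ∷ 1F ∷ []) , _) = refl
triangle-word-index ((2F ∷ 0F ∷ 2F ∷ []) , ())
triangle-word-index ((2F ∷ 1F ∷ 0F ∷ []) , _) = refl
triangle-word-index ((2F ∷ 1F ∷ 1F ∷ []) , ())
triangle-word-index ((2F ∷ 1F ∷ 2F ∷ []) , ())
triangle-word-index ((2F ∷ 2F ∷ 0F ∷ []) , ())
triangle-word-index ((2F ∷ 2F ∷ 1F ∷ []) , ())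
triangle-word-index ((2F ∷ 2F ∷ 2F ∷ []) , ())

triangle-index-word : ∀ i → triangle-index (proj₁ (triangle-word i)) ≡ i
triangle-index-word 0F = refl
triangle-index-word 1F = refl
triangle-index-word 2F = refl
triangle-index-word 3F = refl
triangle-index-word 4F = refl
triangle-index-word 5F = refl

triangle-words : Fin (2 * 3) ↔ Words 3 3
triangle-words = mk↔ₛ′ triangle-word (triangle-index ∘ proj₁) triangle-word-index triangle-index-word

triangle-shortest : IsMinReprLength (cycleGraph 3) 3
triangle-shortest = triangle-word 0F , λ w t → size≤length (Equivalence.to (represents⇔Represents (cycleGraph 3) w) t)

theorem6 : (n : ℕ) → 3 ≤ n →
    Σ ℕ (λ L → IsMinReprLength (cycleGraph n) L ×
      (Fin (2 * n) ↔ Σ (Vec (Fin n) L) (λ w → T (represents (cycleGraph n) (toList w)))))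
theorem6 1 (s≤s ())
theorem6 2 (s≤s (s≤s ()))
theorem6 3 _ = 3 , triangle-shortest , triangle-words
theorem6 (suc m@(suc (suc (suc _)))) _ =
  m + m , shortest-length 3≤m , ↔-trans *↔× (↔-trans (2↔Bool ×-↔ ↔-refl) (words↔ 3≤m))
  where
  3≤m : 3 ≤ m
  3≤m = s≤s (s≤s (s≤s z≤n))
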